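{- Let $(G,\pi)$ be a parity game, $\tau$ a strategy for Odd, $T$ an ordered tree of height $d/2$, and $H:=G_\tau\setminus\bigcup_{v\in B(G_\tau)}\delta^+(v)$. Consider the procedure Dijkstra which, given $\nu:V\to\bar L(T)$: sets $S:=B(G_\tau)$ and $\nu(v):=\top$ for $v\notin S$; for every arc $vw\in E_\tau$ with $w\in S$, $v\notin S$, sets $\nu(v):=\mathrm{drop}(\nu,vw)$; then, while $S\ne V$, picks $u\in\arg\min_{v\in V\setminus S}\Phi^\nu(v)$ (ties broken arbitrarily), adds $u$ to $S$, and for every arc $vu\in E_\tau$ with $v\notin S$ sets $\nu(v):=\mathrm{drop}(\nu,vu)$; finally returns $\nu$. Then for any input $\nu$, Dijkstra returns the pointwise minimal node labeling $\nu^*:V\to\bar L(T)$ which is feasible in $H$ and satisfies $\nu^*(v)=\nu(v)$ for all $v\in B(G_\tau)$.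
   Context: A parity game: finite directed graph $G=(V,E)$, every node with an outgoing arc, $V=V_0\sqcup V_1$, priorities $\pi:V\to\{1,\dots,d\}$, $d$ even. A strategy for Odd is $\tau:V_1\to V$ with $v\tau(v)\in E$; $G_\tau=(V,E_\tau)$ with $E_\tau=\{vw\in E:v\in V_0\}\cup\{v\tau(v):v\in V_1\}$. An Even strategy $\sigma:V_0\to V$ gives $G_\sigma$ (all arcs out of $V_1$, only $v\sigma(v)$ out of $v\in V_0$). For a subgraph $K$: $\pi(K)$ max priority, $K$ even if $\pi(K)$ even, $\Pi(K)$ nodes of priority $\pi(K)$, $K_p$ induced subgraph on nodes of priority $\le p$, $\delta^+(v)$ outgoing arcs. Base nodes $B(G_\tau)$: nodes in $\Pi(C)$ for some even cycle $C$ of $G_\tau$. Ordered trees: prefix-closed sets of tuples over a linearly ordered set, viewed as rooted trees, ordered lexicographically; leaves of a height-$d/2$ tree are at depth $d/2$, written $\xi=(\xi_{d-1},\dots,\xi_1)$; $\xi|_p$ deletes components with index $<p$; $\bar L(T)=L(T)\cup\{\top\}$, $\top$ maximal, $\top|_p=\top$. For $\nu:V\to\bar L(T)$ (labelings ordered pointwise): arc $vw$ non-violated if ($\pi(v)$ even and $\nu(v)|_{\pi(v)}\ge\nu(w)|_{\pi(v)}$) or ($\pi(v)$ odd and ($\nu(v)|_{\pi(v)}>\nu(w)|_{\pi(v)}$ or $\nu(v)=\nu(w)=\top$)); violated otherwise; tight if $\nu(v)$ is the smallest element of $\bar L(T)$ making $vw$ non-violated when substituted for $\nu(v)$; loose if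 neither. $\nu$ is feasible in a subgraph $K$ if some Even strategy $\sigma$, with $v\sigma(v)\in E(K)$ whenever $v\in V_0$ has an outgoing arc in $K$, makes all arcs of $K$ in $G_\sigma$ non-violated. $\mathrm{drop}(\nu,vw)$ is the largest $\xi\in\bar L(T)$ with $\xi\le\nu(v)$ such that $vw$ is not loose after replacing $\nu(v)$ by $\xi$. Potentials: for each even $p\in[d]$ fix $\Phi_p:V\to\mathbb{Z}_{\ge0}$ with $\Phi_p(v)=0$ iff $\pi(v)>p$; $\Phi_p(v)\ge\Phi_p(w)$ whenever $v$ can reach $w$ in $H_p$; $\Phi_p(v)=\Phi_p(w)>0$ iff $v,w$ are strongly connected in $H_p$. $\Phi^\nu(v):=(\Phi_d(v),\nu(v)_{d-1},\Phi_{d-2}(v),\nu(v)_{d-3},\dots,\Phi_2(v),\nu(v)_1)$ if $\nu(v)\ne\top$ and $\infty$ (larger than all tuples) otherwise, compared lexicographically. -}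

module Defs where

open import Data.Nat using (ℕ; zero; suc; _+_; _*_; _∸_; _≤_; _<_; ⌊_/2⌋)
open import Data.Nat.DivMod using (_%_)
open import Data.Bool using (Bool; true; false)
open import Data.Fin using (Fin; _≟_)
open import Data.List using (List; []; _∷_; _∷ʳ_; take; zip; map; upTo; length)
open import Data.List.Membership.Propositional using (_∈_)
open import Data.List.Relation.Unary.All using (All)
open import Data.List.Relation.Unary.Linked using (Linked)
open import Data.List.Relation.Unary.Unique.Propositional using (Unique)
open import Data.Product using (Σ; ∃; _×_; _,_)
open import Data.Sum using (_⊎_)
open import Data.Empty using (⊥)
open import Relation.Nullary using (¬_; yes; no)
open import Relation.Binary.PropositionalEquality using (_≡_)
open import Relation.Binary.Structures using (IsStrictTotalOrder)
open import Function.Bundles using (_⇔_)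

-- Parity games.  Nodes are Fin n.  d = 2 * h (so d is even, h = d/2).

data Player : Set where
  Even Odd : Player

IsEven : ℕ → Set
IsEven p = p % 2 ≡ 0

record Game (n h : ℕ) : Set where
  field
    E     : Fin n → Fin n → Bool
    own   : Fin n → Player                -- V₀ = own⁻¹ Even, V₁ = own⁻¹ Odd
    pri   : Fin n → ℕ
    total : ∀ v → ∃ λ w → E v w ≡ true
    pri-pos   : ∀ v → 1 ≤ pri v
    pri-bound : ∀ v → pri v ≤ 2 * h

-- a strategy for Odd: τ v is only relevant for v ∈ V₁
record OddStrategy {n h : ℕ} (G : Game n h) : Set where
  open Game G
  field
    τ     : Fin n → Fin n
    τ-arc : ∀ v → own v ≡ Odd → E v (τ v) ≡ true

-- A (finite) ordered tree all of whose leaves are at depth h is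
-- determined by its set of leaves L(T); a leaf is a tuple
-- ξ = (ξ_{d-1}, ξ_{d-3}, …, ξ_1) stored as a list of length h.

record Tree (A : Set) (h : ℕ) : Set where
  field
    leaves : List (List A)
    depth  : All (λ ξ → length ξ ≡ h) leaves

data Lbl (A : Set) : Set where
  lf  : List A → Lbl A
  top : Lbl A

data InLbar {A : Set} {h : ℕ} (T : Tree A h) : Lbl A → Set where
  in-top  : InLbar T top
  in-leaf : ∀ {ξ} → ξ ∈ Tree.leaves T → InLbar T (lf ξ)

lexLt : {B : Set} → (B → B → Set) → List B → List B → Set
lexLt _≺_ [] [] = ⊥
lexLt _≺_ [] (y ∷ ys) = ⊥
lexLt _≺_ (x ∷ xs) [] = ⊥
lexLt _≺_ (x ∷ xs) (y ∷ ys) = x ≺ y ⊎ (x ≡ y × lexLt _≺_ xs ys)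

module _ {A : Set} (_≺_ : A → A → Set) where

  ltL : Lbl A → Lbl A → Set
  ltL (lf x) (lf y) = lexLt _≺_ x y
  ltL (lf x) top    = ⊤'
    where open import Data.Unit using () renaming (⊤ to ⊤')
  ltL top    _      = ⊥

  leL : Lbl A → Lbl A → Set
  leL a b = a ≡ b ⊎ ltL a b

-- truncation ξ|_p : delete components with index < p
-- (position i of the list has index d-1-2i, d = 2h)
trunc : {A : Set} → ℕ → ℕ → Lbl A → Lbl A
trunc h p (lf ξ) = lf (take ⌊ (2 * h + 1 ∸ p) /2⌋ ξ)
trunc h p top    = top

module _ {n h : ℕ} (G : Game n h) (σO : OddStrategy G)
         {A : Set} (_≺_ : A → A → Set) (T : Tree A h) where

  open Game G
  open OddStrategy σO

  Lab : Set
  Lab = Fin n → Lbl A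

  InT : Lab → Set
  InT ν = ∀ v → InLbar T (ν v)

  upd : Lab → Fin n → Lbl A → Lab
  upd ν v ξ x with x ≟ v
  ... | yes _ = ξ
  ... | no  _ = ν x

  Eτ : Fin n → Fin n → Set
  Eτ v w = E v w ≡ true × (own v ≡ Even ⊎ (own v ≡ Odd × w ≡ τ v))

  IsCycle : (Fin n → Fin n → Set) → List (Fin n) → Set
  IsCycle R []       = ⊥
  IsCycle R (x ∷ xs) = Unique (x ∷ xs) × Linked R ((x ∷ xs) ∷ʳ x)

  Base : Fin n → Set
  Base v = Σ (List (Fin n)) λ c →
             IsCycle Eτ c × v ∈ c × All (λ u → pri u ≤ pri v) c × IsEven (pri v)

  H : Fin n → Fin n → Set
  H v w = Eτ v w × ¬ Base v

  data Reach (p : ℕ) : Fin n → Fin n → Set where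
    here : ∀ {v} → pri v ≤ p → Reach p v v
    step : ∀ {v w u} → pri v ≤ p → H v w → Reach p w u → Reach p v u

  record Potentials : Set where
    field
      Φ : ℕ → Fin n → ℕ
      Φ-zero : ∀ p → IsEven p → 1 ≤ p → p ≤ 2 * h →
               ∀ v → (Φ p v ≡ 0 ⇔ p < pri v)
      Φ-mono : ∀ p → IsEven p → 1 ≤ p → p ≤ 2 * h →
               ∀ v w → Reach p v w → Φ p w ≤ Φ p v
      Φ-scc  : ∀ p → IsEven p → 1 ≤ p → p ≤ 2 * h →
               ∀ v w → ((Φ p v ≡ Φ p w × 0 < Φ p v) ⇔ (Reach p v w × Reach p w v))

  NonViol : Lab → Fin n → Fin n → Set
  NonViol ν v w =
    (IsEven (pri v) × leL _≺_ (trunc h (pri v) (ν w)) (trunc h (pri v) (ν v)))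
    ⊎ (¬ IsEven (pri v) ×
       (ltL _≺_ (trunc h (pri v) (ν w)) (trunc h (pri v) (ν v))
        ⊎ (ν v ≡ top × ν w ≡ top)))

  Tight : Lab → Fin n → Fin n → Set
  Tight ν v w = InLbar T (ν v) × NonViol ν v w ×
    (∀ ξ → InLbar T ξ → NonViol (upd ν v ξ) v w → leL _≺_ (ν v) ξ)

  Loose : Lab → Fin n → Fin n → Set
  Loose ν v w = NonViol ν v w × ¬ Tight ν v w

  IsDrop : Lab → Fin n → Fin n → Lbl A → Set
  IsDrop ν v w ξ = InLbar T ξ × leL _≺_ ξ (ν v) × ¬ Loose (upd ν v ξ) v w ×
    (∀ ξ' → InLbar T ξ' → leL _≺_ ξ' (ν v) → ¬ Loose (upd ν v ξ') v w → leL _≺_ ξ' ξ)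

  Feasible : (Fin n → Fin n → Set) → Lab → Set
  Feasible K ν = Σ (Fin n → Fin n) λ σ →
    (∀ v → own v ≡ Even → (∃ λ w → K v w) → K v (σ v)) ×
    (∀ v w → K v w → (own v ≡ Odd ⊎ (own v ≡ Even × w ≡ σ v)) → NonViol ν v w)

  data Key : Set where
    fin : List (ℕ × A) → Key
    inf : Key

  pairLt : ℕ × A → ℕ × A → Set
  pairLt (a , x) (b , y) = a < b ⊎ (a ≡ b × x ≺ y)

  keyLt : Key → Key → Set
  keyLt (fin a) (fin b) = lexLt pairLt a b
  keyLt (fin a) inf     = ⊤'
    where open import Data.Unit using () renaming (⊤ to ⊤')
  keyLt inf     _       = ⊥

  keyLe : Key → Key → Set
  keyLe a b = a ≡ b ⊎ keyLt a b

  -- Φ^ν(v) = (Φ_d(v), ν(v)_{d-1}, Φ_{d-2}(v), ν(v)_{d-3}, …, Φ_2(v), ν(v)_1),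
  -- represented as the list of pairs ((Φ_d(v),ν(v)_{d-1}), …, (Φ_2(v),ν(v)_1))
  -- compared lexicographically (same as the interleaved tuple)
  keyOf : Potentials → Lab → Fin n → Key
  keyOf P ν v with ν v
  ... | top  = inf
  ... | lf ξ = fin (zip (map (λ i → Potentials.Φ P (2 * h ∸ 2 * i) v) (upTo h)) ξ)

  -- The procedure Dijkstra, as a relation (input ν, output ν')
  -- (ties and the order within each "for every arc" loop are arbitrary).

  Arc : Set
  Arc = Fin n × Fin n

  Enumerates : List Arc → (Fin n → Fin n → Set) → Set
  Enumerates as P = Unique as × (∀ v w → ((v , w) ∈ as ⇔ P v w))

  data DropSeq : List Arc → Lab → Lab → Set where
    ds-nil  : ∀ {ν} → DropSeq [] ν ν
    ds-cons : ∀ {v w as ν ξ ν'} → IsDrop ν v w ξ →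
              DropSeq as (upd ν v ξ) ν' → DropSeq ((v , w) ∷ as) ν ν'

  data Loop (P : Potentials) : (Fin n → Set) → Lab → Lab → Set₁ where
    lp-done : ∀ {S ν} → (∀ v → S v) → Loop P S ν ν
    lp-step : ∀ {S ν ν₁ ν'} (u : Fin n) (as : List Arc) →
              ¬ S u →
              (∀ v → ¬ S v → keyLe (keyOf P ν u) (keyOf P ν v)) →
              Enumerates as (λ v w → Eτ v w × w ≡ u × ¬ (S v ⊎ v ≡ u)) →
              DropSeq as ν ν₁ →
              Loop P (λ x → S x ⊎ x ≡ u) ν₁ ν' →
              Loop P S ν ν'

  Dijkstra : Potentials → Lab → Lab → Set₁
  Dijkstra P ν ν' = Σ Lab λ ν₁ → Σ Lab λ ν₂ → Σ (List Arc) λ as →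
    (∀ v → (Base v → ν₁ v ≡ ν v) × (¬ Base v → ν₁ v ≡ top)) ×
    Enumerates as (λ v w → Eτ v w × Base w × ¬ Base v) ×
    DropSeq as ν₁ ν₂ ×
    Loop P Base ν₂ ν'

  IsMinFeasible : Lab → Lab → Set
  IsMinFeasible ν ν* =
    InT ν* × Feasible H ν* × (∀ v → Base v → ν* v ≡ ν v) ×
    (∀ μ → InT μ → Feasible H μ → (∀ v → Base v → μ v ≡ ν v) →
       ∀ v → leL _≺_ (ν* v) (μ v))

-- Dijkstra keeps a settled set S ⊇ B(G_τ) with two invariants: every non-base node is labelled ⊤
-- or has a non-violated τ-arc into S, and for every τ-arc vw from outside S into S the label of v
-- is below each label that would make vw non-violated (this is what drop achieves).  The first
-- invariant yields, once S = V, a strategy for Even witnessing feasibility in H.  For minimality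
-- fix a feasible μ that agrees with ν on B(G_τ); inductively ν ≤ μ on S.  Along the arcs kept by μ
-- the key Φ^μ strictly decreases: Φ_p never increases along H_p, and it strictly decreases at an
-- even tail of priority p, since otherwise the tail would close an even cycle and be a base node.
-- Following these arcs from the node u of minimal key Φ^ν, one reaches S, and chaining the
-- inequalities gives Φ^ν(u) ≤ Φ^μ(u), hence ν(u) ≤ μ(u).

module Submission where

open import Defs
open import Data.Nat using (ℕ)
open import Data.Product using (Σ; _×_)
open import Relation.Binary.PropositionalEquality using (_≡_)
open import Relation.Binary.Structures using (IsStrictTotalOrder)

open import Data.Bool as Bool using (true)
open import Data.Empty using (⊥-elim)
open import Data.Fin as Fin using (Fin)
open import Data.List using (List; []; _∷_; _∷ʳ_; take; zip; applyUpTo; length; filter; allFin; cartesianProduct)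
open import Data.List.Properties using (length-take; map-upTo; ∷-injectiveˡ; ∷-injectiveʳ)
open import Data.List.Membership.Propositional using (_∈_; _∉_)
open import Data.List.Membership.Propositional.Properties
  using (∈-allFin; ∈-++⁺ˡ; ∈-++⁺ʳ; ∈-cartesianProduct⁺; ∈-filter⁺; ∈-filter⁻)
open import Data.List.Relation.Unary.All as All using (All; []; _∷_)
open import Data.List.Relation.Unary.All.Properties using (¬Any⇒All¬) renaming (++⁺ to All-++⁺)
open import Data.List.Relation.Unary.AllPairs using ([]; _∷_)
open import Data.List.Relation.Unary.Any as Any using (here; there; any?)
open import Data.List.Relation.Unary.Linked using (Linked; []; [-]; _∷_)
open import Data.List.Relation.Unary.Unique.Propositional using (Unique)
open import Data.List.Relation.Unary.Unique.Propositional.Properties using (filter⁺; cartesianProduct⁺; allFin⁺)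
open import Data.Nat as ℕ using (zero; suc; _+_; _*_; _∸_; _≤_; _<_; z≤n; s≤s; ⌊_/2⌋)
open import Data.Nat.DivMod using (_%_; m*n%n≡0; [m+kn]%n≡m%n)
open import Data.Nat.Induction using (<-wellFounded)
open import Data.Nat.Properties as ℕ using ()
open import Data.Nat.Tactic.RingSolver using (solve-∀)
open import Data.Product using (∃; _,_; proj₁; proj₂)
open import Data.Sum using (_⊎_; inj₁; inj₂)
open import Data.Unit using (⊤; tt)
open import Function using (_∘_; id; case_of_)
open import Function.Bundles using (_⇔_; mk⇔; Equivalence)
open import Induction.WellFounded using (WellFounded; Acc; acc; module Subrelation)
open import Level using (0ℓ)
import Relation.Binary.Construct.On as On
open import Relation.Binary.Definitions using (Transitive; Trichotomous; Tri; tri<; tri≈; tri>; Decidable)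
open import Relation.Binary.PropositionalEquality using (_≢_; refl; sym; trans; cong; cong₂; subst; subst₂)
open import Relation.Nullary using (¬_; Dec; yes; no)
open import Relation.Nullary.Decidable using (map′; ¬?; _×-dec_; _⊎-dec_; decidable-stable)
open import Relation.Unary using (Pred; _⊆_) renaming (Decidable to Decidable₁)

module Lexicographic {B : Set} {_<_ : B → B → Set}
                     (<-trans : Transitive _<_) (<-cmp : Trichotomous _≡_ _<_) where

  <-irrefl : ∀ {x} → ¬ x < x
  <-irrefl {x} with <-cmp x x
  ... | tri< _ x≢x _ = λ _ → x≢x refl
  ... | tri≈ x≮x _ _ = x≮x
  ... | tri> _ x≢x _ = λ _ → x≢x refl

  lex-irrefl : ∀ xs → ¬ lexLt _<_ xs xs
  lex-irrefl (x ∷ xs) (inj₁ x<x)        = <-irrefl x<x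
  lex-irrefl (x ∷ xs) (inj₂ (_ , xs<xs)) = lex-irrefl xs xs<xs

  lex-trans : ∀ xs ys zs → lexLt _<_ xs ys → lexLt _<_ ys zs → lexLt _<_ xs zs
  lex-trans []       []       _        ()                 _
  lex-trans []       (_ ∷ _)  _        ()                 _
  lex-trans (x ∷ xs) (y ∷ ys) (z ∷ zs) (inj₁ x<y)         (inj₁ y<z)         = inj₁ (<-trans x<y y<z)
  lex-trans (x ∷ xs) (y ∷ ys) (z ∷ zs) (inj₁ x<y)         (inj₂ (refl , _))  = inj₁ x<y
  lex-trans (x ∷ xs) (y ∷ ys) (z ∷ zs) (inj₂ (refl , _))  (inj₁ y<z)         = inj₁ y<z
  lex-trans (x ∷ xs) (y ∷ ys) (z ∷ zs) (inj₂ (refl , p)) (inj₂ (refl , q))  = inj₂ (refl , lex-trans xs ys zs p q)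

  lex-compare : ∀ xs ys → length xs ≡ length ys → Tri (lexLt _<_ xs ys) (xs ≡ ys) (lexLt _<_ ys xs)
  lex-compare []       []       _ = tri≈ (λ ()) refl (λ ())
  lex-compare (x ∷ xs) (y ∷ ys) e with <-cmp x y
  ... | tri< x<y x≢y y≮x = tri< (inj₁ x<y) (λ { refl → x≢y refl }) λ { (inj₁ y<x) → y≮x y<x ; (inj₂ (refl , _)) → x≢y refl }
  ... | tri> x≮y x≢y y<x = tri> (λ { (inj₁ x<y) → x≮y x<y ; (inj₂ (refl , _)) → x≢y refl }) (λ { refl → x≢y refl }) (inj₁ y<x)
  ... | tri≈ x≮x refl _ with lex-compare xs ys (ℕ.suc-injective e)
  ...   | tri< p q r = tri< (inj₂ (refl , p)) (λ { refl → q refl }) λ { (inj₁ y<x) → x≮x y<x ; (inj₂ (_ , l)) → r l }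
  ...   | tri≈ p refl r = tri≈ (λ { (inj₁ y<x) → x≮x y<x ; (inj₂ (_ , l)) → p l }) refl λ { (inj₁ y<x) → x≮x y<x ; (inj₂ (_ , l)) → r l }
  ...   | tri> p q r = tri> (λ { (inj₁ y<x) → x≮x y<x ; (inj₂ (_ , l)) → p l }) (λ { refl → q refl }) (inj₂ (refl , r))

  lex-take : ∀ k xs ys → lexLt _<_ xs ys → take k xs ≡ take k ys ⊎ lexLt _<_ (take k xs) (take k ys)
  lex-take zero    xs       ys       _                  = inj₁ refl
  lex-take (suc k) []       []       ()
  lex-take (suc k) []       (_ ∷ _)  ()
  lex-take (suc k) (x ∷ xs) (y ∷ ys) (inj₁ x<y)         = inj₂ (inj₁ x<y)
  lex-take (suc k) (x ∷ xs) (y ∷ ys) (inj₂ (refl , l)) with lex-take k xs ys l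
  ... | inj₁ e  = inj₁ (cong (x ∷_) e)
  ... | inj₂ l′ = inj₂ (inj₂ (refl , l′))

module Truncation where

  private
    double-suc : ∀ r → 2 * suc r ≡ suc (suc (2 * r))
    double-suc = solve-∀

  data Parity : ℕ → Set where
    even : ∀ r → Parity (2 * r)
    odd  : ∀ r → Parity (suc (2 * r))

  parity : ∀ p → Parity p
  parity zero = even 0
  parity (suc p) with parity p
  ... | even r = odd r
  ... | odd r  = subst Parity (double-suc r) (even (suc r))

  double-isEven : ∀ r → IsEven (2 * r)
  double-isEven r = trans (cong (_% 2) (ℕ.*-comm 2 r)) (m*n%n≡0 r 2)

  double+1-isOdd : ∀ r → ¬ IsEven (suc (2 * r))
  double+1-isOdd r ev = ℕ.1+n≢0 (trans (sym remainder-1) ev)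
    where
      remainder-1 : suc (2 * r) % 2 ≡ 1
      remainder-1 = trans (cong (λ t → suc t % 2) (ℕ.*-comm 2 r)) ([m+kn]%n≡m%n 1 r 2)

  ⌊double/2⌋ : ∀ s → ⌊ 2 * s /2⌋ ≡ s
  ⌊double/2⌋ s = trans (cong (λ t → ⌊ s + t /2⌋) (ℕ.+-identityʳ s)) (sym (ℕ.n≡⌊n+n/2⌋ s))

  ⌊double+1/2⌋ : ∀ s → ⌊ suc (2 * s) /2⌋ ≡ s
  ⌊double+1/2⌋ zero    = refl
  ⌊double+1/2⌋ (suc s) = cong suc (trans (cong ⌊_/2⌋ (ℕ.+-suc s (s + 0))) (⌊double+1/2⌋ s))

  record EvenLevel (h q : ℕ) : Set where
    field
      isEven   : IsEven q
      positive : 1 ≤ q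
      bounded  : q ≤ 2 * h

  level-of-index : ∀ {h j} → j < h → EvenLevel h (2 * h ∸ 2 * j)
  level-of-index {h} {j} j<h = record
    { isEven   = subst IsEven (ℕ.*-distribˡ-∸ 2 h j) (double-isEven (h ∸ j))
    ; positive = subst (1 ≤_) (ℕ.*-distribˡ-∸ 2 h j) (ℕ.≤-trans (s≤s z≤n) (ℕ.*-monoʳ-≤ 2 (ℕ.m+n≤o⇒m≤o∸n 1 j<h)))
    ; bounded  = ℕ.m∸n≤m (2 * h) (2 * j)
    }

  private
    level-gap : ∀ r s j → j < s → suc (2 * r) < 2 * (r + s) ∸ 2 * j
    level-gap r s j j<s = ℕ.m+n≤o⇒m≤o∸n (suc (suc (2 * r))) (begin
      suc (suc (2 * r + 2 * j)) ≡⟨ ring₁ r j ⟩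
      2 * r + 2 * suc j         ≤⟨ ℕ.+-monoʳ-≤ (2 * r) (ℕ.*-monoʳ-≤ 2 j<s) ⟩
      2 * r + 2 * s             ≡⟨ ring₂ r s ⟩
      2 * (r + s)               ∎)
      where
        open ℕ.≤-Reasoning
        ring₁ : ∀ r j → suc (suc (2 * r + 2 * j)) ≡ 2 * r + 2 * suc j
        ring₁ = solve-∀
        ring₂ : ∀ r s → 2 * r + 2 * s ≡ 2 * (r + s)
        ring₂ = solve-∀

  -- The truncation ξ|_p keeps the first k = ⌊(d+1-p)/2⌋ components of ξ; component j carries
  -- index d-1-2j and is paired in Φ^ν with the potential of level d-2j.
  record TruncationIndex (h p k : ℕ) : Set where
    field
      k≤h     : k ≤ h
      below   : ∀ j → j < k → p < 2 * h ∸ 2 * j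
      at-even : IsEven p → k < h × 2 * h ∸ 2 * k ≡ p

  private
    index-even : ∀ r s → 1 ≤ r → TruncationIndex (r + s) (2 * r) ⌊ (2 * (r + s) + 1 ∸ 2 * r) /2⌋
    index-even r s 1≤r = subst (TruncationIndex (r + s) (2 * r)) (sym k≡s) (record
      { k≤h     = ℕ.m≤n+m s r
      ; below   = λ j j<s → ℕ.<⇒≤ (level-gap r s j j<s)
      ; at-even = λ _ → ℕ.m<n+m s 1≤r , level-p
      })
      where
        ring₁ : ∀ r s → 2 * (r + s) + 1 ≡ 2 * r + suc (2 * s)
        ring₁ = solve-∀
        ring₂ : ∀ r s → 2 * (r + s) ≡ 2 * s + 2 * r
        ring₂ = solve-∀
        k≡s : ⌊ (2 * (r + s) + 1 ∸ 2 * r) /2⌋ ≡ s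
        k≡s = trans (cong (λ t → ⌊ t ∸ 2 * r /2⌋) (ring₁ r s))
                    (trans (cong ⌊_/2⌋ (ℕ.m+n∸m≡n (2 * r) _)) (⌊double+1/2⌋ s))
        level-p : 2 * (r + s) ∸ 2 * s ≡ 2 * r
        level-p = trans (cong (_∸ 2 * s) (ring₂ r s)) (ℕ.m+n∸m≡n (2 * s) (2 * r))

    index-odd : ∀ r s → TruncationIndex (r + s) (suc (2 * r)) ⌊ (2 * (r + s) + 1 ∸ suc (2 * r)) /2⌋
    index-odd r s = subst (TruncationIndex (r + s) (suc (2 * r))) (sym k≡s) (record
      { k≤h     = ℕ.m≤n+m s r
      ; below   = level-gap r s
      ; at-even = λ ev → ⊥-elim (double+1-isOdd r ev)
      })
      where
        ring : ∀ r s → 2 * (r + s) + 1 ≡ suc (2 * r) + 2 * s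
        ring = solve-∀
        k≡s : ⌊ (2 * (r + s) + 1 ∸ suc (2 * r)) /2⌋ ≡ s
        k≡s = trans (cong (λ t → ⌊ t ∸ suc (2 * r) /2⌋) (ring r s))
                    (trans (cong ⌊_/2⌋ (ℕ.m+n∸m≡n (suc (2 * r)) _)) (⌊double/2⌋ s))

    halve-≤ : ∀ {r h} → 2 * r ≤ 2 * h → ∃ λ s → r + s ≡ h
    halve-≤ {r} {h} 2r≤2h = ℕ.m≤n⇒∃[o]m+o≡n {r} {h} (ℕ.*-cancelˡ-≤ 2 2r≤2h)

  truncation-index : ∀ {h p} → 1 ≤ p → p ≤ 2 * h → TruncationIndex h p ⌊ (2 * h + 1 ∸ p) /2⌋
  truncation-index {h} {p} 1≤p p≤2h with parity p
  truncation-index () _ | even zero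
  truncation-index {h} 1≤p p≤2h | even (suc r) with halve-≤ {suc r} {h} p≤2h
  ...   | s , refl = index-even (suc r) s (s≤s z≤n)
  truncation-index {h} 1≤p p≤2h | odd r with halve-≤ {r} {h} (ℕ.≤-trans (ℕ.n≤1+n (2 * r)) p≤2h)
  ...   | s , refl = index-odd r s

module Counting where

  module _ {B : Set} {P Q : Pred B 0ℓ} (P? : Decidable₁ P) (Q? : Decidable₁ Q) (P⊆Q : P ⊆ Q) where

    filter-⊆-length : ∀ xs → length (filter P? xs) ≤ length (filter Q? xs)
    filter-⊆-length []       = z≤n
    filter-⊆-length (x ∷ xs) with P? x | Q? x
    ... | yes _  | yes _  = s≤s (filter-⊆-length xs)
    ... | yes px | no ¬qx = ⊥-elim (¬qx (P⊆Q px))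
    ... | no _   | yes _  = ℕ.m≤n⇒m≤1+n (filter-⊆-length xs)
    ... | no _   | no _   = filter-⊆-length xs

    filter-⊂-length : ∀ {y} xs → y ∈ xs → Q y → ¬ P y → length (filter P? xs) < length (filter Q? xs)
    filter-⊂-length (x ∷ xs) (here refl) qx ¬px with P? x | Q? x
    ... | yes px | _      = ⊥-elim (¬px px)
    ... | no _   | yes _  = s≤s (filter-⊆-length xs)
    ... | no _   | no ¬qx = ⊥-elim (¬qx qx)
    filter-⊂-length (x ∷ xs) (there y∈xs) qy ¬py with filter-⊂-length xs y∈xs qy ¬py | P? x | Q? x
    ... | ih | yes _  | yes _  = s≤s ih
    ... | ih | yes px | no ¬qx = ⊥-elim (¬qx (P⊆Q px))
    ... | ih | no _   | yes _  = ℕ.m≤n⇒m≤1+n ih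
    ... | ih | no _   | no _   = ih

  -- The number of elements below a node strictly decreases along the order.
  finite-wellFounded : ∀ {n} {_⊏_ : Fin n → Fin n → Set} →
                       Transitive _⊏_ → (∀ {x} → ¬ x ⊏ x) → Decidable _⊏_ → WellFounded _⊏_
  finite-wellFounded {n} {_⊏_} ⊏-trans ⊏-irrefl _⊏?_ =
    Subrelation.wellFounded rank-mono (On.wellFounded rank <-wellFounded)
    where
      rank : Fin n → ℕ
      rank y = length (filter (_⊏? y) (allFin n))
      rank-mono : ∀ {x y} → x ⊏ y → rank x < rank y
      rank-mono {x} {y} x⊏y = filter-⊂-length (_⊏? x) (_⊏? y) (λ z⊏x → ⊏-trans z⊏x x⊏y)
                                              (allFin n) (∈-allFin x) x⊏y ⊏-irrefl

module LabelOrder {A : Set} {_≺_ : A → A → Set} (≺-sto : IsStrictTotalOrder _≡_ _≺_) where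

  open Lexicographic (IsStrictTotalOrder.trans ≺-sto) (IsStrictTotalOrder.compare ≺-sto)

  infix 4 _<ˡ_ _≤ˡ_

  _<ˡ_ : Lbl A → Lbl A → Set
  _<ˡ_ = ltL _≺_

  _≤ˡ_ : Lbl A → Lbl A → Set
  _≤ˡ_ = leL _≺_

  <ˡ-irrefl : ∀ a → ¬ a <ˡ a
  <ˡ-irrefl (lf ξ) = lex-irrefl ξ
  <ˡ-irrefl top    ()

  <ˡ-trans : ∀ a b c → a <ˡ b → b <ˡ c → a <ˡ c
  <ˡ-trans (lf ξ) (lf ζ) (lf η) = lex-trans ξ ζ η
  <ˡ-trans (lf ξ) (lf ζ) top    _ _ = tt
  <ˡ-trans (lf ξ) top    _      _ ()
  <ˡ-trans top    _      _      ()

  ≤ˡ-refl : ∀ {a} → a ≤ˡ a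
  ≤ˡ-refl = inj₁ refl

  ≤ˡ-trans : ∀ a b c → a ≤ˡ b → b ≤ˡ c → a ≤ˡ c
  ≤ˡ-trans a b c (inj₁ refl) b≤c         = b≤c
  ≤ˡ-trans a b c (inj₂ a<b)  (inj₁ refl) = inj₂ a<b
  ≤ˡ-trans a b c (inj₂ a<b)  (inj₂ b<c)  = inj₂ (<ˡ-trans a b c a<b b<c)

  <-≤ˡ-trans : ∀ a b c → a <ˡ b → b ≤ˡ c → a <ˡ c
  <-≤ˡ-trans a b c a<b (inj₁ refl) = a<b
  <-≤ˡ-trans a b c a<b (inj₂ b<c)  = <ˡ-trans a b c a<b b<c

  ≤-<ˡ-trans : ∀ a b c → a ≤ˡ b → b <ˡ c → a <ˡ c
  ≤-<ˡ-trans a b c (inj₁ refl) b<c = b<c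
  ≤-<ˡ-trans a b c (inj₂ a<b)  b<c = <ˡ-trans a b c a<b b<c

  <⇒≱ˡ : ∀ a b → a <ˡ b → ¬ b ≤ˡ a
  <⇒≱ˡ a b a<b (inj₁ refl) = <ˡ-irrefl a a<b
  <⇒≱ˡ a b a<b (inj₂ b<a)  = <ˡ-irrefl a (<ˡ-trans a b a a<b b<a)

  ≤ˡ-antisym : ∀ a b → a ≤ˡ b → b ≤ˡ a → a ≡ b
  ≤ˡ-antisym a b (inj₁ a≡b) _   = a≡b
  ≤ˡ-antisym a b (inj₂ a<b) b≤a = ⊥-elim (<⇒≱ˡ a b a<b b≤a)

  ≤ˡ-top : ∀ a → a ≤ˡ top
  ≤ˡ-top (lf _) = inj₂ tt
  ≤ˡ-top top    = inj₁ refl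

  top-≤ˡ : ∀ {a} → top ≤ˡ a → a ≡ top
  top-≤ˡ (inj₁ e) = sym e

  SameLength : Lbl A → Lbl A → Set
  SameLength (lf ξ) (lf ζ) = length ξ ≡ length ζ
  SameLength _      _      = ⊤

  SameLength-sym : ∀ a b → SameLength a b → SameLength b a
  SameLength-sym (lf _) (lf _) e = sym e
  SameLength-sym (lf _) top    _ = tt
  SameLength-sym top    (lf _) _ = tt
  SameLength-sym top    top    _ = tt

  <ˡ-compare : ∀ a b → SameLength a b → Tri (a <ˡ b) (a ≡ b) (b <ˡ a)
  <ˡ-compare (lf ξ) (lf ζ) e with lex-compare ξ ζ e
  ... | tri< p q r    = tri< p (λ { refl → q refl }) r
  ... | tri≈ p refl r = tri≈ p refl r
  ... | tri> p q r    = tri> p (λ { refl → q refl }) r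
  <ˡ-compare (lf _) top    _ = tri< tt (λ ()) (λ ())
  <ˡ-compare top    (lf _) _ = tri> (λ ()) (λ ()) tt
  <ˡ-compare top    top    _ = tri≈ (λ ()) refl (λ ())

  ≤ˡ-total : ∀ a b → SameLength a b → a ≤ˡ b ⊎ b <ˡ a
  ≤ˡ-total a b s with <ˡ-compare a b s
  ... | tri< a<b _ _ = inj₁ (inj₂ a<b)
  ... | tri≈ _ a≡b _ = inj₁ (inj₁ a≡b)
  ... | tri> _ _ b<a = inj₂ b<a

  ≤ˡ-dec : ∀ a b → SameLength a b → Dec (a ≤ˡ b)
  ≤ˡ-dec a b s with ≤ˡ-total a b s
  ... | inj₁ a≤b = yes a≤b
  ... | inj₂ b<a = no (<⇒≱ˡ b a b<a)

  <ˡ-dec : ∀ a b → SameLength a b → Dec (a <ˡ b)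
  <ˡ-dec a b s with ≤ˡ-total b a (SameLength-sym a b s)
  ... | inj₁ b≤a = no λ a<b → <⇒≱ˡ a b a<b b≤a
  ... | inj₂ a<b = yes a<b

  trunc-mono : ∀ h p {a b} → a ≤ˡ b → trunc h p a ≤ˡ trunc h p b
  trunc-mono h p (inj₁ refl) = inj₁ refl
  trunc-mono h p {lf ξ} {lf ζ} (inj₂ ξ<ζ) with lex-take ⌊ (2 * h + 1 ∸ p) /2⌋ ξ ζ ξ<ζ
  ... | inj₁ e  = inj₁ (cong lf e)
  ... | inj₂ l  = inj₂ l
  trunc-mono h p {lf _} {top} (inj₂ _) = inj₂ tt

  trunc-sameLength : ∀ h p a b → SameLength a b → SameLength (trunc h p a) (trunc h p b)
  trunc-sameLength h p (lf ξ) (lf ζ) e =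
    trans (length-take _ ξ) (trans (cong (⌊ (2 * h + 1 ∸ p) /2⌋ ℕ.⊓_) e) (sym (length-take _ ζ)))
  trunc-sameLength h p (lf _) top    _ = tt
  trunc-sameLength h p top    (lf _) _ = tt
  trunc-sameLength h p top    top    _ = tt

module TreeLabels {A : Set} {_≺_ : A → A → Set} (≺-sto : IsStrictTotalOrder _≡_ _≺_)
                  {h : ℕ} (T : Tree A h) where

  open LabelOrder ≺-sto

  InL̄ : Lbl A → Set
  InL̄ = InLbar T

  leaf-length : ∀ {ξ} → InL̄ (lf ξ) → length ξ ≡ h
  leaf-length (in-leaf ξ∈T) = All.lookup (Tree.depth T) ξ∈T

  sameLength : ∀ {a b} → InL̄ a → InL̄ b → SameLength a b
  sameLength in-top       in-top       = tt
  sameLength in-top       (in-leaf _)  = tt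
  sameLength (in-leaf _)  in-top       = tt
  sameLength (in-leaf ξ∈) (in-leaf ζ∈) = trans (leaf-length (in-leaf ξ∈)) (sym (leaf-length (in-leaf ζ∈)))

  -- NonViol ν v w unfolds to NonViolated (pri v) (ν v) (ν w).
  NonViolated : ℕ → Lbl A → Lbl A → Set
  NonViolated p a b = (IsEven p × trunc h p b ≤ˡ trunc h p a)
                    ⊎ (¬ IsEven p × (trunc h p b <ˡ trunc h p a ⊎ (a ≡ top × b ≡ top)))

  nonViolated-monoˡ : ∀ p {a a′ b} → a ≤ˡ a′ → NonViolated p a b → NonViolated p a′ b
  nonViolated-monoˡ p {a} {a′} {b} a≤a′ (inj₁ (ev , b≤a)) =
    inj₁ (ev , ≤ˡ-trans (trunc h p b) (trunc h p a) (trunc h p a′) b≤a (trunc-mono h p a≤a′))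
  nonViolated-monoˡ p {a} {a′} {b} a≤a′ (inj₂ (od , inj₁ b<a)) =
    inj₂ (od , inj₁ (<-≤ˡ-trans (trunc h p b) (trunc h p a) (trunc h p a′) b<a (trunc-mono h p a≤a′)))
  nonViolated-monoˡ p a≤a′ (inj₂ (od , inj₂ (refl , refl))) = inj₂ (od , inj₂ (top-≤ˡ a≤a′ , refl))

  nonViolated-antitoneʳ : ∀ p {a b b′} → b′ ≤ˡ b → NonViolated p a b → NonViolated p a b′
  nonViolated-antitoneʳ p {a} {b} {b′} b′≤b (inj₁ (ev , b≤a)) =
    inj₁ (ev , ≤ˡ-trans (trunc h p b′) (trunc h p b) (trunc h p a) (trunc-mono h p b′≤b) b≤a)
  nonViolated-antitoneʳ p {a} {b} {b′} b′≤b (inj₂ (od , inj₁ b<a)) =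
    inj₂ (od , inj₁ (≤-<ˡ-trans (trunc h p b′) (trunc h p b) (trunc h p a) (trunc-mono h p b′≤b) b<a))
  nonViolated-antitoneʳ p {b′ = lf _} b′≤b (inj₂ (od , inj₂ (refl , refl))) = inj₂ (od , inj₁ tt)
  nonViolated-antitoneʳ p {b′ = top}  b′≤b (inj₂ (od , inj₂ (refl , refl))) = inj₂ (od , inj₂ (refl , refl))

  isEven? : ∀ p → Dec (IsEven p)
  isEven? p = p % 2 ℕ.≟ 0

  nonViolated-top : ∀ p b → NonViolated p top b
  nonViolated-top p b with isEven? p
  nonViolated-top p b      | yes ev = inj₁ (ev , ≤ˡ-top (trunc h p b))
  nonViolated-top p (lf _) | no od  = inj₂ (od , inj₁ tt)
  nonViolated-top p top    | no od  = inj₂ (od , inj₂ (refl , refl))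

  nonViolated? : ∀ p {a b} → InL̄ a → InL̄ b → Dec (NonViolated p a b)
  nonViolated? p {a} {b} a∈ b∈ with isEven? p
  ... | yes ev = map′ (λ b≤a → inj₁ (ev , b≤a)) (λ { (inj₁ (_ , b≤a)) → b≤a ; (inj₂ (od , _)) → ⊥-elim (od ev) })
                      (≤ˡ-dec _ _ (trunc-sameLength h p b a (sameLength b∈ a∈)))
  ... | no od with a
  ...   | top  = yes (nonViolated-top p b)
  ...   | lf ξ = map′ (λ b<a → inj₂ (od , inj₁ b<a))
                      (λ { (inj₁ (ev , _)) → ⊥-elim (od ev) ; (inj₂ (_ , inj₁ b<a)) → b<a ; (inj₂ (_ , inj₂ (() , _))) })
                      (<ˡ-dec _ _ (trunc-sameLength h p b (lf ξ) (sameLength b∈ a∈)))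

  LowerBound : ℕ → Lbl A → Lbl A → Set
  LowerBound p a b = ∀ y → InL̄ y → NonViolated p y b → a ≤ˡ y

  lowerBound-antitone : ∀ p {a a′ b} → a′ ≤ˡ a → LowerBound p a b → LowerBound p a′ b
  lowerBound-antitone p {a} {a′} a′≤a a-lb y y∈ nv = ≤ˡ-trans a′ a y a′≤a (a-lb y y∈ nv)

  violated⇒lowerBound : ∀ p {a b} → InL̄ a → ¬ NonViolated p a b → LowerBound p a b
  violated⇒lowerBound p {a} a∈ ¬nv y y∈ nv with ≤ˡ-total a y (sameLength a∈ y∈)
  ... | inj₁ a≤y = a≤y
  ... | inj₂ y<a = ⊥-elim (¬nv (nonViolated-monoˡ p (inj₂ y<a) nv))

  module _ (Q : Lbl A → Set) (Q? : ∀ {x} → InL̄ x → Dec (Q x)) where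

    Least : Lbl A → Set
    Least t = InL̄ t × Q t × (∀ y → InL̄ y → Q y → t ≤ˡ y)

    private
      least-below : ∀ t → InL̄ t → Q t → (ls : List (List A)) → All (λ ξ → InL̄ (lf ξ)) ls →
                    Σ (Lbl A) λ t′ → InL̄ t′ × Q t′ × t′ ≤ˡ t × All (λ ξ → Q (lf ξ) → t′ ≤ˡ lf ξ) ls
      least-below t t∈ qt []       []          = t , t∈ , qt , ≤ˡ-refl , []
      least-below t t∈ qt (ξ ∷ ls) (ξ∈ ∷ ls∈) with Q? ξ∈
      ... | no ¬qξ with least-below t t∈ qt ls ls∈
      ...   | t′ , t′∈ , qt′ , t′≤t , below = t′ , t′∈ , qt′ , t′≤t , (λ qξ → ⊥-elim (¬qξ qξ)) ∷ below
      least-below t t∈ qt (ξ ∷ ls) (ξ∈ ∷ ls∈) | yes qξ with ≤ˡ-total t (lf ξ) (sameLength t∈ ξ∈)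
      ... | inj₁ t≤ξ with least-below t t∈ qt ls ls∈
      ...   | t′ , t′∈ , qt′ , t′≤t , below =
              t′ , t′∈ , qt′ , t′≤t , (λ _ → ≤ˡ-trans t′ t (lf ξ) t′≤t t≤ξ) ∷ below
      least-below t t∈ qt (ξ ∷ ls) (ξ∈ ∷ ls∈) | yes qξ | inj₂ ξ<t with least-below (lf ξ) ξ∈ qξ ls ls∈
      ...   | t′ , t′∈ , qt′ , t′≤ξ , below =
              t′ , t′∈ , qt′ , ≤ˡ-trans t′ (lf ξ) t t′≤ξ (inj₂ ξ<t) , (λ _ → t′≤ξ) ∷ below

    least : Q top → Σ (Lbl A) Least
    least q⊤ with least-below top in-top q⊤ (Tree.leaves T) (All.tabulate in-leaf)
    ... | t , t∈ , qt , _ , below = t , t∈ , qt , λ where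
      top      _             _  → ≤ˡ-top t
      (lf ξ) (in-leaf ξ∈T) qξ → All.lookup below ξ∈T qξ

  least-nonViolating : ∀ p {b} → InL̄ b → Σ (Lbl A) λ t → InL̄ t × NonViolated p t b × LowerBound p t b
  least-nonViolating p {b} b∈ = least (λ x → NonViolated p x b) (λ x∈ → nonViolated? p x∈ b∈) (nonViolated-top p b)

  -- Label-level readings of ¬ Loose and IsDrop for an arc vw with v ≠ w, tail priority p,
  -- tail label a and head label b.
  NotLoose : ℕ → Lbl A → Lbl A → Set
  NotLoose p ξ b = NonViolated p ξ b → LowerBound p ξ b

  record IsDropˡ (p : ℕ) (a b ξ : Lbl A) : Set where
    field
      inL̄      : InL̄ ξ
      ≤tail    : ξ ≤ˡ a
      notLoose : NotLoose p ξ b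
      greatest : ∀ ξ′ → InL̄ ξ′ → ξ′ ≤ˡ a → NotLoose p ξ′ b → ξ′ ≤ˡ ξ

  module _ (p : ℕ) {a b : Lbl A} (a∈ : InL̄ a) (b∈ : InL̄ b) where

    drop-lowerBound : ∀ {ξ} → IsDropˡ p a b ξ → LowerBound p ξ b
    drop-lowerBound d with nonViolated? p (IsDropˡ.inL̄ d) b∈
    ... | yes nv = IsDropˡ.notLoose d nv
    ... | no ¬nv = violated⇒lowerBound p (IsDropˡ.inL̄ d) ¬nv

    drop-kept-or-nonViolated : ∀ {ξ} → IsDropˡ p a b ξ → ξ ≡ a ⊎ NonViolated p ξ b
    drop-kept-or-nonViolated {ξ} d with nonViolated? p (IsDropˡ.inL̄ d) b∈
    ... | yes nvξ = inj₂ nvξ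
    ... | no ¬nvξ with nonViolated? p a∈ b∈
    ...   | no ¬nva = inj₁ (≤ˡ-antisym ξ a (IsDropˡ.≤tail d) (IsDropˡ.greatest d a a∈ ≤ˡ-refl (λ nva → ⊥-elim (¬nva nva))))
    ...   | yes nva with least-nonViolating p b∈
    ...     | t , t∈ , nvt , t-lb =
              ⊥-elim (¬nvξ (nonViolated-monoˡ p (IsDropˡ.greatest d t t∈ (t-lb a a∈ nva) (λ _ → t-lb)) nvt))

    drop-exists : Σ (Lbl A) (IsDropˡ p a b)
    drop-exists with nonViolated? p a∈ b∈
    ... | no ¬nva = a , record
          { inL̄ = a∈ ; ≤tail = ≤ˡ-refl ; notLoose = λ nva → ⊥-elim (¬nva nva) ; greatest = λ _ _ ξ′≤a _ → ξ′≤a }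
    ... | yes nva with least-nonViolating p b∈
    ...   | t , t∈ , nvt , t-lb = t , record
          { inL̄ = t∈ ; ≤tail = t-lb a a∈ nva ; notLoose = λ _ → t-lb ; greatest = greatest }
      where
        greatest : ∀ ξ′ → InL̄ ξ′ → ξ′ ≤ˡ a → NotLoose p ξ′ b → ξ′ ≤ˡ t
        greatest ξ′ ξ′∈ _ ξ′-notLoose with ≤ˡ-total ξ′ t (sameLength ξ′∈ t∈)
        ... | inj₁ ξ′≤t = ξ′≤t
        ... | inj₂ t<ξ′ = ⊥-elim (<⇒≱ˡ t ξ′ t<ξ′ (ξ′-notLoose (nonViolated-monoˡ p (inj₂ t<ξ′) nvt) t t∈ nvt))

module Correctness {n h : ℕ} (G : Game n h) (strategy : OddStrategy G)
                   {A : Set} (_≺_ : A → A → Set) (≺-sto : IsStrictTotalOrder _≡_ _≺_) (T : Tree A h) where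

  open Game G
  open OddStrategy strategy
  open LabelOrder ≺-sto
  open TreeLabels ≺-sto T
  open Counting
  open import Data.List.Membership.DecPropositional (Fin._≟_ {n}) using (_∈?_)

  Labelling : Set
  Labelling = Lab G strategy _≺_ T

  IntoL̄ : Labelling → Set
  IntoL̄ = InT G strategy _≺_ T

  _[_≔_] : Labelling → Fin n → Lbl A → Labelling
  _[_≔_] = upd G strategy _≺_ T

  infix 4 _⟶_ _⟶ᴴ_

  _⟶_ : Fin n → Fin n → Set
  _⟶_ = Eτ G strategy _≺_ T

  _⟶ᴴ_ : Fin n → Fin n → Set
  _⟶ᴴ_ = H G strategy _≺_ T

  IsBase : Fin n → Set
  IsBase = Base G strategy _≺_ T

  open Equivalence using (to; from)

  upd-same : ∀ ν v ξ → (ν [ v ≔ ξ ]) v ≡ ξ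
  upd-same ν v ξ with v Fin.≟ v
  ... | yes _   = refl
  ... | no v≢v = ⊥-elim (v≢v refl)

  upd-other : ∀ ν v ξ {x} → x ≢ v → (ν [ v ≔ ξ ]) x ≡ ν x
  upd-other ν v ξ {x} x≢v with x Fin.≟ v
  ... | yes x≡v = ⊥-elim (x≢v x≡v)
  ... | no _    = refl

  upd-intoL̄ : ∀ {ν} v {ξ} → IntoL̄ ν → InL̄ ξ → IntoL̄ (ν [ v ≔ ξ ])
  upd-intoL̄ v ν∈ ξ∈ x with x Fin.≟ v
  ... | yes _ = ξ∈
  ... | no _  = ν∈ x

  upd-≤ : ∀ ν v {ξ} → ξ ≤ˡ ν v → ∀ x → (ν [ v ≔ ξ ]) x ≤ˡ ν x
  upd-≤ ν v ξ≤ x with x Fin.≟ v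
  ... | yes refl = ξ≤
  ... | no _     = ≤ˡ-refl

  module _ {v w : Fin n} (w≢v : w ≢ v) where

    nonViol-upd : ∀ {ν ξ} → NonViol G strategy _≺_ T (ν [ v ≔ ξ ]) v w ⇔ NonViolated (pri v) ξ (ν w)
    nonViol-upd {ν} {ξ} = mk⇔ (subst₂ (NonViolated (pri v)) (upd-same ν v ξ) (upd-other ν v ξ w≢v))
                          (subst₂ (NonViolated (pri v)) (sym (upd-same ν v ξ)) (sym (upd-other ν v ξ w≢v)))

    private
      nonViol-reupd : ∀ {ν ξ ξ′} → NonViol G strategy _≺_ T ((ν [ v ≔ ξ ]) [ v ≔ ξ′ ]) v w ⇔ NonViolated (pri v) ξ′ (ν w)
      nonViol-reupd {ν} {ξ} {ξ′} = mk⇔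
        (λ nv → subst (NonViolated (pri v) ξ′) (upd-other ν v ξ w≢v) (to (nonViol-upd {ν [ v ≔ ξ ]}) nv))
        (λ nv → from (nonViol-upd {ν [ v ≔ ξ ]}) (subst (NonViolated (pri v) ξ′) (sym (upd-other ν v ξ w≢v)) nv))

    notLoose-upd : ∀ {ν ξ} → InL̄ ξ → (¬ Loose G strategy _≺_ T (ν [ v ≔ ξ ]) v w) ⇔ NotLoose (pri v) ξ (ν w)
    notLoose-upd {ν} {ξ} ξ∈ = mk⇔ ¬loose⇒notLoose notLoose⇒¬loose
      where
        ¬loose⇒notLoose : ¬ Loose G strategy _≺_ T (ν [ v ≔ ξ ]) v w → NotLoose (pri v) ξ (ν w)
        ¬loose⇒notLoose ¬loose nv y y∈ nvy with ≤ˡ-dec ξ y (sameLength ξ∈ y∈)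
        ... | yes ξ≤y = ξ≤y
        ... | no ξ≰y  = ⊥-elim (¬loose (from (nonViol-upd {ν}) nv , λ (_ , _ , least) →
                          ξ≰y (subst (_≤ˡ y) (upd-same ν v ξ) (least y y∈ (from (nonViol-reupd {ν}) nvy)))))
        notLoose⇒¬loose : NotLoose (pri v) ξ (ν w) → ¬ Loose G strategy _≺_ T (ν [ v ≔ ξ ]) v w
        notLoose⇒¬loose notLoose (nv , ¬tight) = ¬tight
          ( subst InL̄ (sym (upd-same ν v ξ)) ξ∈
          , nv
          , λ y y∈ nvy → subst (_≤ˡ y) (sym (upd-same ν v ξ)) (notLoose (to (nonViol-upd {ν}) nv) y y∈ (to (nonViol-reupd {ν}) nvy)))

    isDrop⇔isDropˡ : ∀ {ν ξ} → IsDrop G strategy _≺_ T ν v w ξ ⇔ IsDropˡ (pri v) (ν v) (ν w) ξ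
    isDrop⇔isDropˡ = mk⇔
      (λ (ξ∈ , ξ≤ , ¬loose , greatest) → record
        { inL̄ = ξ∈ ; ≤tail = ξ≤ ; notLoose = to (notLoose-upd ξ∈) ¬loose
        ; greatest = λ ξ′ ξ′∈ ξ′≤ nl → greatest ξ′ ξ′∈ ξ′≤ (from (notLoose-upd ξ′∈) nl) })
      (λ d → let open IsDropˡ d in
        inL̄ , ≤tail , from (notLoose-upd inL̄) notLoose ,
        λ ξ′ ξ′∈ ξ′≤ ¬loose → greatest ξ′ ξ′∈ ξ′≤ (to (notLoose-upd ξ′∈) ¬loose))

  -- Sequences of drops

  Drops : List (Fin n × Fin n) → Labelling → Labelling → Set
  Drops = DropSeq G strategy _≺_ T

  Progress : (Fin n → Set) → Labelling → Fin n → Set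
  Progress S ν v = ν v ≡ top ⊎ Σ (Fin n) λ w → S w × v ⟶ w × NonViolated (pri v) (ν v) (ν w)

  progress-mono : ∀ {S S′ ν v} → (∀ {x} → S x → S′ x) → Progress S ν v → Progress S′ ν v
  progress-mono S⊆S′ (inj₁ νv≡⊤)              = inj₁ νv≡⊤
  progress-mono S⊆S′ (inj₂ (w , sw , e , nv)) = inj₂ (w , S⊆S′ sw , e , nv)

  progress-transport : ∀ {S ν ν′ v} → ν′ v ≡ ν v → (∀ {w} → S w → ν′ w ≡ ν w) → Progress S ν v → Progress S ν′ v
  progress-transport eqv eqS (inj₁ νv≡⊤)            = inj₁ (trans eqv νv≡⊤)
  progress-transport {v = v} eqv eqS (inj₂ (w , sw , e , nv)) =
    inj₂ (w , sw , e , subst₂ (NonViolated (pri v)) (sym eqv) (sym (eqS sw)) nv)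

  module DropSequences (S : Fin n → Set) where

    IntoS : List (Fin n × Fin n) → Set
    IntoS as = ∀ {v w} → (v , w) ∈ as → v ⟶ w × S w × ¬ S v

    private
      distinct : ∀ {v w} → S w → ¬ S v → w ≢ v
      distinct sw ¬sv refl = ¬sv sw

    drops-intoL̄ : ∀ {as ν ν′} → Drops as ν ν′ → IntoS as → IntoL̄ ν → IntoL̄ ν′
    drops-intoL̄ ds-nil                   _    ν∈ = ν∈
    drops-intoL̄ (ds-cons {v} d rest) into ν∈ = drops-intoL̄ rest (into ∘ there) (upd-intoL̄ v ν∈ (proj₁ d))

    drops-≤ : ∀ {as ν ν′} → Drops as ν ν′ → ∀ x → ν′ x ≤ˡ ν x
    drops-≤ ds-nil                             x = ≤ˡ-refl
    drops-≤ (ds-cons {v} {ν = ν} {ξ} d rest) x = ≤ˡ-trans _ _ _ (drops-≤ rest x) (upd-≤ ν v (proj₁ (proj₂ d)) x)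

    drops-frozen : ∀ {as ν ν′} → Drops as ν ν′ → IntoS as → ∀ {x} → S x → ν′ x ≡ ν x
    drops-frozen ds-nil                             _    _  = refl
    drops-frozen (ds-cons {v} {ν = ν} {ξ} d rest) into sx =
      trans (drops-frozen rest (into ∘ there) sx) (upd-other ν v ξ (distinct sx (proj₂ (proj₂ (into (here refl))))))

    drops-lowerBound : ∀ {as ν ν′} → Drops as ν ν′ → IntoS as → IntoL̄ ν →
                       ∀ {v w} → (v , w) ∈ as → LowerBound (pri v) (ν′ v) (ν′ w)
    drops-lowerBound (ds-cons {v} {w} {ν = ν} {ξ} {ν′} d rest) into ν∈ (here refl) =
      subst (LowerBound (pri v) (ν′ v)) (sym (drops-frozen rest (into ∘ there) sw))
        (lowerBound-antitone (pri v) (drops-≤ rest v) ξ-lb)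
      where
        sw : S w
        sw = proj₁ (proj₂ (into (here refl)))
        w≢v : w ≢ v
        w≢v = distinct sw (proj₂ (proj₂ (into (here refl))))
        ξ-lb : LowerBound (pri v) ((ν [ v ≔ ξ ]) v) ((ν [ v ≔ ξ ]) w)
        ξ-lb = subst₂ (LowerBound (pri v)) (sym (upd-same ν v ξ)) (sym (upd-other ν v ξ w≢v))
                 (drop-lowerBound (pri v) (ν∈ v) (ν∈ w) (to (isDrop⇔isDropˡ w≢v) d))
    drops-lowerBound (ds-cons {v₀} {ν = ν} {ξ} d rest) into ν∈ (there vw∈) =
      drops-lowerBound rest (into ∘ there) (upd-intoL̄ v₀ ν∈ (proj₁ d)) vw∈

    drops-progress : ∀ {as ν ν′} → Drops as ν ν′ → IntoS as → IntoL̄ ν →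
                     (∀ {v} → ¬ S v → Progress S ν v) → ∀ {v} → ¬ S v → Progress S ν′ v
    drops-progress ds-nil _ _ progress = progress
    drops-progress (ds-cons {v₀} {w₀} {ν = ν} {ξ} d rest) into ν∈ progress =
      drops-progress rest (into ∘ there) (upd-intoL̄ v₀ ν∈ (proj₁ d)) progress′
      where
        e₀ : v₀ ⟶ w₀
        e₀ = proj₁ (into (here refl))
        sw₀ : S w₀
        sw₀ = proj₁ (proj₂ (into (here refl)))
        ¬sv₀ : ¬ S v₀
        ¬sv₀ = proj₂ (proj₂ (into (here refl)))
        w₀≢v₀ : w₀ ≢ v₀
        w₀≢v₀ = distinct sw₀ ¬sv₀
        frozen : ∀ {w} → S w → (ν [ v₀ ≔ ξ ]) w ≡ ν w
        frozen sw = upd-other ν v₀ ξ (distinct sw ¬sv₀)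
        by-node : ∀ v → Dec (v ≡ v₀) → ¬ S v → Progress S (ν [ v₀ ≔ ξ ]) v
        by-node v (no v≢v₀) ¬sv = progress-transport (upd-other ν v₀ ξ v≢v₀) frozen (progress ¬sv)
        by-node v (yes refl) ¬sv with drop-kept-or-nonViolated (pri v) (ν∈ v) (ν∈ w₀) (to (isDrop⇔isDropˡ w₀≢v₀) d)
        ... | inj₁ ξ≡ = progress-transport (trans (upd-same ν v ξ) ξ≡) frozen (progress ¬sv)
        ... | inj₂ nv  = inj₂ (w₀ , sw₀ , e₀ , subst₂ (NonViolated (pri v)) (sym (upd-same ν v ξ)) (sym (frozen sw₀)) nv)
        progress′ : ∀ {v} → ¬ S v → Progress S (ν [ v₀ ≔ ξ ]) v
        progress′ {v} = by-node v (v Fin.≟ v₀)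

  -- Base nodes and closed walks

  data Walk (p : ℕ) : Fin n → Fin n → Set where
    stop : ∀ {x} → pri x ≤ p → Walk p x x
    step : ∀ {x y z} → pri x ≤ p → x ⟶ y → Walk p y z → Walk p x z

  walk-++ : ∀ {p x y z} → Walk p x y → Walk p y z → Walk p x z
  walk-++ (stop _)        w′ = w′
  walk-++ (step px e w) w′ = step px e (walk-++ w w′)

  walk-end : ∀ {p x y} → Walk p x y → pri y ≤ p
  walk-end (stop py)     = py
  walk-end (step _ _ w) = walk-end w

  reach⇒walk : ∀ {p x y} → Reach G strategy _≺_ T p x y → Walk p x y
  reach⇒walk (here px)         = stop px
  reach⇒walk (step px (e , _) r) = step px e (reach⇒walk r)

  Return : ℕ → Fin n → Set
  Return p v = Σ (Fin n) λ y → v ⟶ y × Walk p y v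

  return-rotate : ∀ {p x v} → Return p x → Walk p x v → Walk p v x → Return p v
  return-rotate ret          _   (stop _)              = ret
  return-rotate (_ , _ , _) x⇝v (step _ e y⇝x) = _ , e , walk-++ y⇝x x⇝v

  SimplePath : ℕ → Fin n → Fin n → List (Fin n) → Set
  SimplePath p v a ys = Unique (a ∷ ys) × v ∉ (a ∷ ys) × Linked _⟶_ ((a ∷ ys) ∷ʳ v) × All (λ u → pri u ≤ p) (a ∷ ys)

  private
    simplePath-from : ∀ {p v a b ys} → a ∈ (b ∷ ys) → SimplePath p v b ys → ∃ (SimplePath p v a)
    simplePath-from (here refl) path = _ , path
    simplePath-from {ys = _ ∷ _} (there a∈) (_ ∷ uniq , v∉ , _ ∷ linked , _ ∷ bounded) =
      simplePath-from a∈ (uniq , v∉ ∘ there , linked , bounded)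

    simplePath-extend : ∀ {p v a b ys} → pri a ≤ p → a ⟶ b → a ≢ v → SimplePath p v b ys → ∃ (SimplePath p v a)
    simplePath-extend {a = a} {b} {ys} pa e a≢v path@(uniq , v∉ , linked , bounded) with a ∈? (b ∷ ys)
    ... | yes a∈ = simplePath-from a∈ path
    ... | no a∉  = b ∷ ys , ¬Any⇒All¬ (b ∷ ys) a∉ ∷ uniq , (λ { (here v≡a) → a≢v (sym v≡a) ; (there v∈) → v∉ v∈ }) ,
                   e ∷ linked , pa ∷ bounded

  walk⇒simplePath : ∀ {p a v} → Walk p a v → a ≡ v ⊎ ∃ (SimplePath p v a)
  walk⇒simplePath (stop _) = inj₁ refl
  walk⇒simplePath {a = a} {v} (step pa e w) with a Fin.≟ v | walk⇒simplePath w
  ... | yes a≡v | _              = inj₁ a≡v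
  ... | no a≢v  | inj₁ refl      = inj₂ ([] , [] ∷ [] , (λ { (here v≡a) → a≢v (sym v≡a) }) , e ∷ [-] , pa ∷ [])
  ... | no a≢v  | inj₂ (_ , path) = inj₂ (simplePath-extend pa e a≢v path)

  return⇒base : ∀ {v} → IsEven (pri v) → Return (pri v) v → IsBase v
  return⇒base {v} ev (y , e , y⇝v) with walk⇒simplePath y⇝v
  ... | inj₁ refl = v ∷ [] , ([] ∷ [] , e ∷ [-]) , here refl , ℕ.≤-refl ∷ [] , ev
  ... | inj₂ (ys , uniq , v∉ , linked , bounded) =
        v ∷ y ∷ ys , (¬Any⇒All¬ (y ∷ ys) v∉ ∷ uniq , e ∷ linked) , here refl , ℕ.≤-refl ∷ bounded , ev

  private
    walks-along : ∀ {p} a us z → Linked _⟶_ (a ∷ us ∷ʳ z) → All (λ u → pri u ≤ p) (a ∷ us ∷ʳ z) →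
                  ∀ {u} → u ∈ (a ∷ us ∷ʳ z) → Walk p a u × Walk p u z
    walks-along a []       z (e ∷ [-]) (pa ∷ pz ∷ []) (here refl)         = stop pa , step pa e (stop pz)
    walks-along a []       z (e ∷ [-]) (pa ∷ pz ∷ []) (there (here refl)) = step pa e (stop pz) , stop pz
    walks-along a (b ∷ us) z (e ∷ linked) (pa ∷ bounded) (here refl) =
      stop pa , step pa e (proj₂ (walks-along b us z linked bounded (here refl)))
    walks-along a (b ∷ us) z (e ∷ linked) (pa ∷ bounded) (there u∈) =
      let b⇝u , u⇝z = walks-along b us z linked bounded u∈ in step pa e b⇝u , u⇝z

    head-return : ∀ {p} x xs → Linked _⟶_ (x ∷ xs ∷ʳ x) → All (λ u → pri u ≤ p) (x ∷ xs ∷ʳ x) → Return p x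
    head-return x []       (e ∷ [-])    (px ∷ _)       = x , e , stop px
    head-return x (b ∷ xs) (e ∷ linked) (_ ∷ bounded) =
      b , e , proj₁ (walks-along b xs x linked bounded (∈-++⁺ʳ (b ∷ xs) (here refl)))

  base⇒return : ∀ {v} → IsBase v → IsEven (pri v) × Return (pri v) v
  base⇒return {v} (x ∷ xs , (_ , linked) , v∈ , bounded , ev) =
    ev , return-rotate (head-return x xs linked bounded′) x⇝v v⇝x
    where
      bounded′ : All (λ u → pri u ≤ pri v) (x ∷ xs ∷ʳ x)
      bounded′ = All-++⁺ bounded (All.head bounded ∷ [])
      x⇝v = proj₁ (walks-along x xs x linked bounded′ (∈-++⁺ˡ v∈))
      v⇝x = proj₂ (walks-along x xs x linked bounded′ (∈-++⁺ˡ v∈))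

  _≟ᴾ_ : (a b : Player) → Dec (a ≡ b)
  Even ≟ᴾ Even = yes refl
  Even ≟ᴾ Odd  = no λ ()
  Odd  ≟ᴾ Even = no λ ()
  Odd  ≟ᴾ Odd  = yes refl

  arc? : ∀ v w → Dec (v ⟶ w)
  arc? v w = (E v w Bool.≟ true) ×-dec ((own v ≟ᴾ Even) ⊎-dec ((own v ≟ᴾ Odd) ×-dec (w Fin.≟ τ v)))

  module Predecessors (p : ℕ) (v : Fin n) where

    Closed : List (Fin n) → Set
    Closed F = ∀ {a b} → a ⟶ b → b ∈ F → pri a ≤ p → a ∈ F

    closed-complete : ∀ {F a} → Closed F → v ∈ F → Walk p a v → a ∈ F
    closed-complete closed v∈F (stop _)      = v∈F
    closed-complete closed v∈F (step pa e w) = closed e (closed-complete closed v∈F w) pa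

    outside : List (Fin n) → ℕ
    outside F = length (filter (λ x → ¬? (x ∈? F)) (allFin n))

    close : ∀ k F → outside F < k → All (λ a → Walk p a v) F →
            Σ (List (Fin n)) λ F′ → All (λ a → Walk p a v) F′ × (∀ {x} → x ∈ F → x ∈ F′) × Closed F′
    close (suc k) F out<k F⇝v with any? (λ (a , b) → ¬? (a ∈? F) ×-dec (b ∈? F ×-dec (pri a ℕ.≤? p ×-dec arc? a b)))
                                        (cartesianProduct (allFin n) (allFin n))
    ... | no none = F , F⇝v , id , closed
      where
        closed : Closed F
        closed {a} {b} e b∈F pa with a ∈? F
        ... | yes a∈F = a∈F
        ... | no a∉F  = ⊥-elim (none (Any.map (λ { refl → a∉F , b∈F , pa , e })
                                             (∈-cartesianProduct⁺ (∈-allFin a) (∈-allFin b))))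
    ... | yes some with Any.satisfied some
    ...   | (a , b) , a∉F , b∈F , pa , e with close k (a ∷ F) out<k′ (step pa e (All.lookup F⇝v b∈F) ∷ F⇝v)
      where
        out<k′ : outside (a ∷ F) < k
        out<k′ = ℕ.<-≤-trans (filter-⊂-length (λ x → ¬? (x ∈? (a ∷ F))) (λ x → ¬? (x ∈? F)) (λ x∉ x∈ → x∉ (there x∈))
                                              (allFin n) (∈-allFin a) a∉F (λ a∉ → a∉ (here refl)))
                             (ℕ.≤-pred out<k)
    ...     | F′ , F′⇝v , F⊆F′ , closed = F′ , F′⇝v , F⊆F′ ∘ there , closed

  walk? : ∀ p a v → Dec (Walk p a v)
  walk? p a v with pri v ℕ.≤? p
  ... | no pv≰p = no (pv≰p ∘ walk-end)
  ... | yes pv≤p with Predecessors.close p v (suc (Predecessors.outside p v (v ∷ []))) (v ∷ []) ℕ.≤-refl (stop pv≤p ∷ [])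
  ...   | F , F⇝v , v∈F , closed =
          map′ (All.lookup F⇝v) (Predecessors.closed-complete p v closed (v∈F (here refl))) (a ∈? F)

  return? : ∀ p v → Dec (Return p v)
  return? p v = map′ Any.satisfied (λ (y , e , w) → Any.map (λ { refl → e , w }) (∈-allFin y))
                     (any? (λ y → arc? v y ×-dec walk? p y v) (allFin n))

  isBase? : ∀ v → Dec (IsBase v)
  isBase? v = map′ (λ (ev , ret) → return⇒base ev ret) base⇒return (isEven? (pri v) ×-dec return? (pri v) v)

  -- The potential Φ^ν

  Key′ : Set
  Key′ = Key G strategy _≺_ T

  infix 4 _<ᵖ_ _<ᵏ_ _≤ᵏ_

  _<ᵖ_ : ℕ × A → ℕ × A → Set
  _<ᵖ_ = pairLt G strategy _≺_ T

  _<ᵏ_ : Key′ → Key′ → Set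
  _<ᵏ_ = keyLt G strategy _≺_ T

  _≤ᵏ_ : Key′ → Key′ → Set
  _≤ᵏ_ = keyLe G strategy _≺_ T

  <ᵖ-trans : Transitive _<ᵖ_
  <ᵖ-trans {_ , _} {_ , _} {_ , _} (inj₁ a<b)         (inj₁ b<c)         = inj₁ (ℕ.<-trans a<b b<c)
  <ᵖ-trans {_ , _} {_ , _} {_ , _} (inj₁ a<b)         (inj₂ (refl , _))  = inj₁ a<b
  <ᵖ-trans {_ , _} {_ , _} {_ , _} (inj₂ (refl , _))  (inj₁ b<c)         = inj₁ b<c
  <ᵖ-trans {_ , _} {_ , _} {_ , _} (inj₂ (refl , x<y)) (inj₂ (refl , y<z)) = inj₂ (refl , IsStrictTotalOrder.trans ≺-sto x<y y<z)

  <ᵖ-compare : Trichotomous _≡_ _<ᵖ_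
  <ᵖ-compare (a , x) (b , y) with ℕ.<-cmp a b
  ... | tri< a<b a≢b b≮a = tri< (inj₁ a<b) (λ { refl → a≢b refl }) λ { (inj₁ b<a) → b≮a b<a ; (inj₂ (refl , _)) → a≢b refl }
  ... | tri> a≮b a≢b b<a = tri> (λ { (inj₁ a<b) → a≮b a<b ; (inj₂ (refl , _)) → a≢b refl }) (λ { refl → a≢b refl }) (inj₁ b<a)
  ... | tri≈ a≮a refl _ with IsStrictTotalOrder.compare ≺-sto x y
  ...   | tri< x<y x≢y y⊀x = tri< (inj₂ (refl , x<y)) (λ { refl → x≢y refl }) λ { (inj₁ a<a) → a≮a a<a ; (inj₂ (_ , y<x)) → y⊀x y<x }
  ...   | tri≈ x⊀x refl _  = tri≈ (λ { (inj₁ a<a) → a≮a a<a ; (inj₂ (_ , x<x)) → x⊀x x<x }) refl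
                                  (λ { (inj₁ a<a) → a≮a a<a ; (inj₂ (_ , x<x)) → x⊀x x<x })
  ...   | tri> x⊀y x≢y y<x = tri> (λ { (inj₁ a<a) → a≮a a<a ; (inj₂ (_ , x<y)) → x⊀y x<y }) (λ { refl → x≢y refl }) (inj₂ (refl , y<x))

  private
    module PairLex = Lexicographic <ᵖ-trans <ᵖ-compare

  keyˡ : (ℕ → ℕ) → Lbl A → Key′
  keyˡ f (lf ξ) = fin (zip (applyUpTo f h) ξ)
  keyˡ f top    = inf

  levels : Potentials G strategy _≺_ T → Fin n → ℕ → ℕ
  levels P v i = Potentials.Φ P (2 * h ∸ 2 * i) v

  key : Potentials G strategy _≺_ T → Labelling → Fin n → Key′
  key = keyOf G strategy _≺_ T

  key≡keyˡ : ∀ P ν v → key P ν v ≡ keyˡ (levels P v) (ν v)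
  key≡keyˡ P ν v with ν v
  ... | lf ξ = cong (λ fs → fin (zip fs ξ)) (map-upTo (levels P v) h)
  ... | top  = refl

  zip-length : ∀ {m} (f : ℕ → ℕ) (xs : List A) → length xs ≡ m → length (zip (applyUpTo f m) xs) ≡ m
  zip-length {zero}  f []       _ = refl
  zip-length {suc m} f (x ∷ xs) e = cong suc (zip-length (f ∘ suc) xs (ℕ.suc-injective e))

  zip-injective : ∀ {m} (f : ℕ → ℕ) (xs ys : List A) → length xs ≡ m → length ys ≡ m →
                  zip (applyUpTo f m) xs ≡ zip (applyUpTo f m) ys → xs ≡ ys
  zip-injective {zero}  f []       []       _  _  _ = refl
  zip-injective {suc m} f (x ∷ xs) (y ∷ ys) ex ey e =
    cong₂ _∷_ (cong proj₂ (∷-injectiveˡ e)) (zip-injective (f ∘ suc) xs ys (ℕ.suc-injective ex) (ℕ.suc-injective ey) (∷-injectiveʳ e))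

  zip-lex⁺ : ∀ {m} (f : ℕ → ℕ) (xs ys : List A) → length xs ≡ m → length ys ≡ m →
             lexLt _≺_ xs ys → lexLt _<ᵖ_ (zip (applyUpTo f m) xs) (zip (applyUpTo f m) ys)
  zip-lex⁺ {zero}  f []       []       _  _  ()
  zip-lex⁺ {zero}  f []       (_ ∷ _)  _  () _
  zip-lex⁺ {zero}  f (_ ∷ _)  _        () _  _
  zip-lex⁺ {suc m} f (x ∷ xs) (y ∷ ys) _  _  (inj₁ x≺y)        = inj₁ (inj₂ (refl , x≺y))
  zip-lex⁺ {suc m} f (x ∷ xs) (y ∷ ys) ex ey (inj₂ (refl , l)) =
    inj₂ (refl , zip-lex⁺ (f ∘ suc) xs ys (ℕ.suc-injective ex) (ℕ.suc-injective ey) l)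

  zip-lex⁻ : ∀ {m} (f : ℕ → ℕ) (xs ys : List A) → lexLt _<ᵖ_ (zip (applyUpTo f m) xs) (zip (applyUpTo f m) ys) → lexLt _≺_ xs ys
  zip-lex⁻ {zero}  f _        _        ()
  zip-lex⁻ {suc m} f []       []       ()
  zip-lex⁻ {suc m} f []       (_ ∷ _)  ()
  zip-lex⁻ {suc m} f (_ ∷ _)  []       ()
  zip-lex⁻ {suc m} f (x ∷ xs) (y ∷ ys) (inj₁ (inj₁ fx<fx))     = ⊥-elim (ℕ.<-irrefl refl fx<fx)
  zip-lex⁻ {suc m} f (x ∷ xs) (y ∷ ys) (inj₁ (inj₂ (_ , x≺y))) = inj₁ x≺y
  zip-lex⁻ {suc m} f (x ∷ xs) (y ∷ ys) (inj₂ (refl , l))       = inj₂ (refl , zip-lex⁻ (f ∘ suc) xs ys l)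

  zip-lex-prefix : ∀ {m} k (fv fw : ℕ → ℕ) (xv xw : List A) → length xv ≡ m → length xw ≡ m → k ≤ m →
                   (∀ j → j < k → fw j ≤ fv j) →
                   lexLt _≺_ (take k xw) (take k xv) ⊎ (take k xw ≡ take k xv × k < m × fw k < fv k) →
                   lexLt _<ᵖ_ (zip (applyUpTo fw m) xw) (zip (applyUpTo fv m) xv)
  zip-lex-prefix {suc m} zero fv fw (a ∷ xv) (b ∷ xw) _ _ _ _ (inj₂ (_ , _ , fw0<fv0)) = inj₁ (inj₁ fw0<fv0)
  zip-lex-prefix {suc m} (suc k) fv fw (a ∷ xv) (b ∷ xw) ev ew (s≤s k≤m) fw≤fv prefix
    with ℕ.m≤n⇒m<n∨m≡n (fw≤fv 0 (s≤s z≤n))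
       | zip-lex-prefix k (fv ∘ suc) (fw ∘ suc) xv xw (ℕ.suc-injective ev) (ℕ.suc-injective ew) k≤m
                        (λ j j<k → fw≤fv (suc j) (s≤s j<k))
  ... | inj₁ fw0<fv0 | _ = inj₁ (inj₁ fw0<fv0)
  ... | inj₂ fw0≡fv0 | rest with prefix
  ...   | inj₁ (inj₁ b≺a)        = inj₁ (inj₂ (fw0≡fv0 , b≺a))
  ...   | inj₁ (inj₂ (b≡a , l))  = inj₂ (cong₂ _,_ fw0≡fv0 b≡a , rest (inj₁ l))
  ...   | inj₂ (e , s≤s k<m , lt) = inj₂ (cong₂ _,_ fw0≡fv0 (∷-injectiveˡ e) , rest (inj₂ (∷-injectiveʳ e , k<m , lt)))

  <ᵏ-trans : ∀ a b c → a <ᵏ b → b <ᵏ c → a <ᵏ c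
  <ᵏ-trans (fin a) (fin b) (fin c) = PairLex.lex-trans a b c
  <ᵏ-trans (fin _) (fin _) inf     _ _ = tt
  <ᵏ-trans (fin _) inf     _       _ ()
  <ᵏ-trans inf     _       _       ()

  <ᵏ-irrefl : ∀ a → ¬ a <ᵏ a
  <ᵏ-irrefl (fin a) = PairLex.lex-irrefl a
  <ᵏ-irrefl inf     ()

  ≤ᵏ-trans : ∀ a b c → a ≤ᵏ b → b ≤ᵏ c → a ≤ᵏ c
  ≤ᵏ-trans a b c (inj₁ refl) b≤c         = b≤c
  ≤ᵏ-trans a b c (inj₂ a<b)  (inj₁ refl) = inj₂ a<b
  ≤ᵏ-trans a b c (inj₂ a<b)  (inj₂ b<c)  = inj₂ (<ᵏ-trans a b c a<b b<c)

  ≤-<ᵏ-trans : ∀ a b c → a ≤ᵏ b → b <ᵏ c → a ≤ᵏ c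
  ≤-<ᵏ-trans a b c (inj₁ refl) b<c = inj₂ b<c
  ≤-<ᵏ-trans a b c (inj₂ a<b)  b<c = inj₂ (<ᵏ-trans a b c a<b b<c)

  ≤ᵏ-inf : ∀ a → a ≤ᵏ inf
  ≤ᵏ-inf (fin _) = inj₂ tt
  ≤ᵏ-inf inf     = inj₁ refl

  KeyLength : Key′ → Set
  KeyLength (fin ps) = length ps ≡ h
  KeyLength inf      = ⊤

  <ᵏ-compare : ∀ a b → KeyLength a → KeyLength b → Tri (a <ᵏ b) (a ≡ b) (b <ᵏ a)
  <ᵏ-compare (fin a) (fin b) la lb with PairLex.lex-compare a b (trans la (sym lb))
  ... | tri< p q r    = tri< p (λ { refl → q refl }) r
  ... | tri≈ p refl r = tri≈ p refl r
  ... | tri> p q r    = tri> p (λ { refl → q refl }) r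
  <ᵏ-compare (fin _) inf     _ _ = tri< tt (λ ()) (λ ())
  <ᵏ-compare inf     (fin _) _ _ = tri> (λ ()) (λ ()) tt
  <ᵏ-compare inf     inf     _ _ = tri≈ (λ ()) refl (λ ())

  keyˡ-length : ∀ f {a} → InL̄ a → KeyLength (keyˡ f a)
  keyˡ-length f {lf ξ} ξ∈ = zip-length f ξ (leaf-length ξ∈)
  keyˡ-length f {top}  _  = tt

  keyˡ-mono : ∀ f {a b} → InL̄ a → InL̄ b → a ≤ˡ b → keyˡ f a ≤ᵏ keyˡ f b
  keyˡ-mono f                 _  _  (inj₁ refl) = inj₁ refl
  keyˡ-mono f {lf ξ} {lf ζ} ξ∈ ζ∈ (inj₂ ξ<ζ)  = inj₂ (zip-lex⁺ f ξ ζ (leaf-length ξ∈) (leaf-length ζ∈) ξ<ζ)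
  keyˡ-mono f {lf _} {top}  _  _  (inj₂ _)    = inj₂ tt

  lf-injective : ∀ {ξ ζ : List A} → lf ξ ≡ lf ζ → ξ ≡ ζ
  lf-injective refl = refl

  keyˡ-reflect : ∀ f {a b} → InL̄ a → InL̄ b → keyˡ f a ≤ᵏ keyˡ f b → a ≤ˡ b
  keyˡ-reflect f {lf ξ} {lf ζ} ξ∈ ζ∈ (inj₁ e) =
    inj₁ (cong lf (zip-injective f ξ ζ (leaf-length ξ∈) (leaf-length ζ∈) (fin-injective e)))
    where fin-injective : ∀ {ps qs} → Key.fin ps ≡ fin qs → ps ≡ qs
          fin-injective refl = refl
  keyˡ-reflect f {lf ξ} {lf ζ} _ _ (inj₂ l)  = inj₂ (zip-lex⁻ f ξ ζ l)
  keyˡ-reflect f {lf _} {top}  _ _ _         = inj₂ tt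
  keyˡ-reflect f {top}  {lf _} _ _ (inj₁ ())
  keyˡ-reflect f {top}  {lf _} _ _ (inj₂ ())
  keyˡ-reflect f {top}  {top}  _ _ _         = inj₁ refl

  module _ (P : Potentials G strategy _≺_ T) where

    open Potentials P
    open Truncation

    potential-nonincreasing : ∀ {v w q} → v ⟶ᴴ w → EvenLevel h q → pri v ≤ q → Φ q w ≤ Φ q v
    potential-nonincreasing {v} {w} {q} vw level pv≤q with pri w ℕ.≤? q
    ... | yes pw≤q = Φ-mono q isEven positive bounded v w (step pv≤q vw (here pw≤q))
      where open EvenLevel level
    ... | no pw≰q  = subst (_≤ Φ q v) (sym (from (Φ-zero q isEven positive bounded w) (ℕ.≰⇒> pw≰q))) z≤n
      where open EvenLevel level

    -- Equality would put w and v in one strongly connected component of H_{π(v)}, closing an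
    -- even cycle through v on which π(v) is maximal; but tails of H-arcs are not base nodes.
    potential-decreases : ∀ {v w} → v ⟶ᴴ w → IsEven (pri v) → Φ (pri v) w < Φ (pri v) v
    potential-decreases {v} {w} vw@(e , ¬base) ev =
      ℕ.≤∧≢⇒< (potential-nonincreasing vw level ℕ.≤-refl) Φw≢Φv
      where
        level : EvenLevel h (pri v)
        level = record { isEven = ev ; positive = pri-pos v ; bounded = pri-bound v }
        Φv>0 : 0 < Φ (pri v) v
        Φv>0 = ℕ.n≢0⇒n>0 (λ Φv≡0 → ℕ.<-irrefl refl (to (Φ-zero (pri v) ev (pri-pos v) (pri-bound v) v) Φv≡0))
        Φw≢Φv : Φ (pri v) w ≢ Φ (pri v) v
        Φw≢Φv Φw≡Φv = ¬base (return⇒base ev (w , e , reach⇒walk (proj₂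
          (to (Φ-scc (pri v) ev (pri-pos v) (pri-bound v) v w) (sym Φw≡Φv , Φv>0)))))

    keyˡ-decreases : ∀ {v w ξ ζ} → v ⟶ᴴ w → InL̄ (lf ξ) → InL̄ (lf ζ) → NonViolated (pri v) (lf ξ) (lf ζ) →
                     keyˡ (levels P w) (lf ζ) <ᵏ keyˡ (levels P v) (lf ξ)
    keyˡ-decreases {v} {w} {ξ} {ζ} vw ξ∈ ζ∈ nv =
      zip-lex-prefix k (levels P v) (levels P w) ξ ζ (leaf-length ξ∈) (leaf-length ζ∈) k≤h
        (λ j j<k → potential-nonincreasing vw (level-of-index (ℕ.<-≤-trans j<k k≤h)) (ℕ.<⇒≤ (below j j<k)))
        (prefix nv)
      where
        k = ⌊ (2 * h + 1 ∸ pri v) /2⌋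
        open TruncationIndex (truncation-index {h} (pri-pos v) (pri-bound v))
        prefix : NonViolated (pri v) (lf ξ) (lf ζ) →
                 lexLt _≺_ (take k ζ) (take k ξ) ⊎ (take k ζ ≡ take k ξ × k < h × levels P w k < levels P v k)
        prefix (inj₁ (ev , inj₁ eq))       = inj₂ (lf-injective eq , proj₁ (at-even ev) ,
          subst (λ q → Φ q w < Φ q v) (sym (proj₂ (at-even ev))) (potential-decreases vw ev))
        prefix (inj₁ (_ , inj₂ ζ<ξ))       = inj₁ ζ<ξ
        prefix (inj₂ (_ , inj₁ ζ<ξ))       = inj₁ ζ<ξ
        prefix (inj₂ (_ , inj₂ (() , _)))

    key-decreases : ∀ {μ v w} → IntoL̄ μ → v ⟶ᴴ w → μ v ≢ top → NonViolated (pri v) (μ v) (μ w) → key P μ w <ᵏ key P μ v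
    key-decreases {μ} {v} {w} μ∈ vw μv≢⊤ nv =
      subst₂ _<ᵏ_ (sym (key≡keyˡ P μ w)) (sym (key≡keyˡ P μ v)) (by-labels (μ∈ v) (μ∈ w) μv≢⊤ nv)
      where
        by-labels : ∀ {a b} → InL̄ a → InL̄ b → a ≢ top → NonViolated (pri v) a b → keyˡ (levels P w) b <ᵏ keyˡ (levels P v) a
        by-labels {top}            _  _  a≢⊤ _  = ⊥-elim (a≢⊤ refl)
        by-labels {lf ξ} {lf ζ}    ξ∈ ζ∈ _   nv = keyˡ-decreases vw ξ∈ ζ∈ nv
        by-labels {lf ξ} {top}     _  _  _   (inj₁ (_ , b≤a)) with top-≤ˡ b≤a
        ... | ()
        by-labels {lf ξ} {top}     _  _  _   (inj₂ (_ , inj₁ ()))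
        by-labels {lf ξ} {top}     _  _  _   (inj₂ (_ , inj₂ (() , _)))

  key-mono : ∀ P ν μ v → InL̄ (ν v) → InL̄ (μ v) → ν v ≤ˡ μ v → key P ν v ≤ᵏ key P μ v
  key-mono P ν μ v νv∈ μv∈ νv≤μv =
    subst₂ _≤ᵏ_ (sym (key≡keyˡ P ν v)) (sym (key≡keyˡ P μ v)) (keyˡ-mono (levels P v) νv∈ μv∈ νv≤μv)

  key-reflect : ∀ P ν μ v → InL̄ (ν v) → InL̄ (μ v) → key P ν v ≤ᵏ key P μ v → ν v ≤ˡ μ v
  key-reflect P ν μ v νv∈ μv∈ k≤k =
    keyˡ-reflect (levels P v) νv∈ μv∈ (subst₂ _≤ᵏ_ (key≡keyˡ P ν v) (key≡keyˡ P μ v) k≤k)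

  key-length : ∀ P ν v → InL̄ (ν v) → KeyLength (key P ν v)
  key-length P ν v νv∈ = subst KeyLength (sym (key≡keyˡ P ν v)) (keyˡ-length (levels P v) νv∈)

  key-top : ∀ P ν v → ν v ≡ top → key P ν v ≡ inf
  key-top P ν v νv≡⊤ = trans (key≡keyˡ P ν v) (cong (keyˡ (levels P v)) νv≡⊤)

  -- Correctness of every run

  FeasibleInH : Labelling → Set
  FeasibleInH = Feasible G strategy _≺_ T _⟶ᴴ_

  feasible-successor : ∀ {μ} → FeasibleInH μ → ∀ {v} → ¬ IsBase v →
                       Σ (Fin n) λ w → v ⟶ᴴ w × NonViolated (pri v) (μ v) (μ w)
  feasible-successor {μ} (σ , σ-arc , nonViol) {v} ¬base = by-owner (own v) refl
    where
      by-owner : ∀ pl → own v ≡ pl → Σ (Fin n) λ w → v ⟶ᴴ w × NonViolated (pri v) (μ v) (μ w)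
      by-owner Even own-v = σ v , vσv , nonViol v (σ v) vσv (inj₂ (own-v , refl))
        where
          vσv : v ⟶ᴴ σ v
          vσv = σ-arc v own-v (proj₁ (total v) , (proj₂ (total v) , inj₁ own-v) , ¬base)
      by-owner Odd own-v = τ v , vτv , nonViol v (τ v) vτv (inj₁ own-v)
        where
          vτv : v ⟶ᴴ τ v
          vτv = (τ-arc v own-v , inj₂ (own-v , refl)) , ¬base

  is-top? : (a : Lbl A) → Dec (a ≡ top)
  is-top? (lf _) = no λ ()
  is-top? top    = yes refl

  module Settling (P : Potentials G strategy _≺_ T) {μ : Labelling} (μ∈ : IntoL̄ μ) (μ-feasible : FeasibleInH μ)
                  {S : Fin n → Set} (S? : ∀ x → Dec (S x)) (base⊆S : ∀ {v} → IsBase v → S v)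
                  {ν : Labelling} (ν∈ : IntoL̄ ν) (ν≤μ : ∀ {x} → S x → ν x ≤ˡ μ x)
                  (bounds : ∀ {v w} → ¬ S v → S w → v ⟶ w → LowerBound (pri v) (ν v) (ν w))
                  {u : Fin n} (u-min : ∀ {v} → ¬ S v → key P ν u ≤ᵏ key P ν v) where

    private
      _⊏_ : Fin n → Fin n → Set
      w ⊏ v = key P μ w <ᵏ key P μ v

      ⊏-wellFounded : WellFounded _⊏_
      ⊏-wellFounded = finite-wellFounded (λ {x} {y} {z} → <ᵏ-trans (key P μ x) (key P μ y) (key P μ z))
                                         (λ {x} → <ᵏ-irrefl (key P μ x)) _⊏?_
        where
          _⊏?_ : Decidable _⊏_
          w ⊏? v with <ᵏ-compare (key P μ w) (key P μ v) (key-length P μ w (μ∈ w)) (key-length P μ v (μ∈ v))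
          ... | tri< w⊏v _ _ = yes w⊏v
          ... | tri≈ w⋢v _ _ = no w⋢v
          ... | tri> w⋢v _ _ = no w⋢v

      below-unsettled : ∀ v → Acc _⊏_ v → ¬ S v → key P ν u ≤ᵏ key P μ v
      below-unsettled v (acc rec) ¬sv with feasible-successor {μ} μ-feasible (¬sv ∘ base⊆S)
      ... | w , vw , nv with S? w
      ...   | yes sw = ≤ᵏ-trans (key P ν u) (key P ν v) (key P μ v) (u-min ¬sv)
                         (key-mono P ν μ v (ν∈ v) (μ∈ v) (bounds ¬sv sw (proj₁ vw) (μ v) (μ∈ v)
                            (nonViolated-antitoneʳ (pri v) (ν≤μ sw) nv)))
      ...   | no ¬sw = case is-top? (μ v) of λ where
                (yes μv≡⊤) → subst (key P ν u ≤ᵏ_) (sym (key-top P μ v μv≡⊤)) (≤ᵏ-inf (key P ν u))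
                (no μv≢⊤)  → let w⊏v = key-decreases P μ∈ vw μv≢⊤ nv in
                             ≤-<ᵏ-trans (key P ν u) (key P μ w) (key P μ v) (below-unsettled w (rec w⊏v) ¬sw) w⊏v

    settled-below : ¬ S u → ν u ≤ˡ μ u
    settled-below ¬su = key-reflect P ν μ u (ν∈ u) (μ∈ u) (below-unsettled u (⊏-wellFounded u) ¬su)

  odd-arc-target : ∀ {v w} → own v ≡ Odd → v ⟶ w → w ≡ τ v
  odd-arc-target own-v (_ , inj₁ own-v′)      with trans (sym own-v) own-v′
  ... | ()
  odd-arc-target own-v (_ , inj₂ (_ , w≡τv)) = w≡τv

  -- Even plays along the arcs that witness progress; ⊤-labelled nodes violate no arc.
  progress⇒feasible : ∀ {S ν} → (∀ {v} → ¬ IsBase v → Progress S ν v) → FeasibleInH ν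
  progress⇒feasible {S} {ν} progress = σ , σ-arc , nonViol
    where
      σ : Fin n → Fin n
      σ v with isBase? v
      ... | yes _ = v
      ... | no ¬base with progress ¬base
      ...   | inj₁ _           = proj₁ (total v)
      ...   | inj₂ (w , _)     = w

      σ-arc : ∀ v → own v ≡ Even → ∃ (v ⟶ᴴ_) → v ⟶ᴴ σ v
      σ-arc v own-v (_ , _ , ¬base) with isBase? v
      ... | yes base = ⊥-elim (¬base base)
      ... | no ¬base′ with progress ¬base′
      ...   | inj₁ _               = (proj₂ (total v) , inj₁ own-v) , ¬base′
      ...   | inj₂ (_ , _ , e , _) = e , ¬base′

      nonViol : ∀ v w → v ⟶ᴴ w → own v ≡ Odd ⊎ (own v ≡ Even × w ≡ σ v) → NonViol G strategy _≺_ T ν v w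
      nonViol v w (e , ¬base) played with isBase? v
      ... | yes base = ⊥-elim (¬base base)
      ... | no ¬base′ with progress ¬base′
      ...   | inj₁ νv≡⊤ = subst (λ a → NonViolated (pri v) a (ν w)) (sym νv≡⊤) (nonViolated-top (pri v) (ν w))
      ...   | inj₂ (w′ , _ , e′ , nv′) with played
      ...     | inj₂ (_ , refl) = nv′
      ...     | inj₁ own-v      = subst (λ x → NonViolated (pri v) (ν v) (ν x))
                                        (trans (odd-arc-target own-v e′) (sym (odd-arc-target own-v e))) nv′

  record Invariant (ν₀ : Labelling) (S : Fin n → Set) (ν : Labelling) : Set where
    field
      S?       : ∀ x → Dec (S x)
      base⊆S   : ∀ {v} → IsBase v → S v
      intoL̄    : IntoL̄ ν
      on-base  : ∀ {v} → IsBase v → ν v ≡ ν₀ v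
      progress : ∀ {v} → ¬ IsBase v → Progress S ν v
      bounds   : ∀ {v w} → ¬ S v → S w → v ⟶ w → LowerBound (pri v) (ν v) (ν w)

  Enumerates′ : List (Fin n × Fin n) → (Fin n → Fin n → Set) → Set
  Enumerates′ = Enumerates G strategy _≺_ T

  module Round {ν₀ S ν ν₁} (inv : Invariant ν₀ S ν) (u : Fin n) {as}
               (enum : Enumerates′ as (λ v w → v ⟶ w × w ≡ u × ¬ (S v ⊎ v ≡ u))) (drops : Drops as ν ν₁) where

    open Invariant inv

    S′ : Fin n → Set
    S′ x = S x ⊎ x ≡ u

    open DropSequences S′

    into : IntoS as
    into {v} {w} vw∈ with to (proj₂ enum v w) vw∈
    ... | e , refl , ¬s′v = e , inj₂ refl , ¬s′v

    frozen : ∀ {x} → S′ x → ν₁ x ≡ ν x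
    frozen = drops-frozen drops into

    S′? : ∀ x → Dec (S′ x)
    S′? x = S? x ⊎-dec (x Fin.≟ u)

    invariant : Invariant ν₀ S′ ν₁
    invariant = record
      { S?       = S′?
      ; base⊆S   = inj₁ ∘ base⊆S
      ; intoL̄    = drops-intoL̄ drops into intoL̄
      ; on-base  = λ base → trans (frozen (inj₁ (base⊆S base))) (on-base base)
      ; progress = progress′
      ; bounds   = bounds′
      }
      where
        progress′ : ∀ {v} → ¬ IsBase v → Progress S′ ν₁ v
        progress′ {v} ¬base with S′? v
        ... | yes s′v = progress-transport (frozen s′v) frozen (progress-mono inj₁ (progress ¬base))
        ... | no ¬s′v = drops-progress drops into intoL̄
                          (λ {x} ¬s′x → progress-mono inj₁ (progress (¬s′x ∘ inj₁ ∘ base⊆S))) ¬s′v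
        bounds′ : ∀ {v w} → ¬ S′ v → S′ w → v ⟶ w → LowerBound (pri v) (ν₁ v) (ν₁ w)
        bounds′ {v} ¬s′v (inj₁ sw) e =
          subst (LowerBound (pri v) (ν₁ v)) (sym (frozen (inj₁ sw)))
            (lowerBound-antitone (pri v) (drops-≤ drops v) (bounds (¬s′v ∘ inj₁) sw e))
        bounds′ {v} ¬s′v (inj₂ refl) e = drops-lowerBound drops into intoL̄ (from (proj₂ enum v u) (e , refl , ¬s′v))

    below : ∀ P {μ} → IntoL̄ μ → FeasibleInH μ → ¬ S u → (∀ {v} → ¬ S v → key P ν u ≤ᵏ key P ν v) →
            (∀ {x} → S x → ν x ≤ˡ μ x) → ∀ {x} → S′ x → ν₁ x ≤ˡ μ x
    below P {μ} μ∈ μ-feasible ¬su u-min ν≤μ (inj₁ sx) = subst (_≤ˡ μ _) (sym (frozen (inj₁ sx))) (ν≤μ sx)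
    below P {μ} μ∈ μ-feasible ¬su u-min ν≤μ (inj₂ refl) =
      subst (_≤ˡ μ u) (sym (frozen (inj₂ refl)))
        (Settling.settled-below P μ∈ μ-feasible S? base⊆S intoL̄ ν≤μ bounds u-min ¬su)

  Loop′ : Potentials G strategy _≺_ T → (Fin n → Set) → Labelling → Labelling → Set₁
  Loop′ = Loop G strategy _≺_ T

  loop-invariant : ∀ {P ν₀ S ν ν′} → Loop′ P S ν ν′ → Invariant ν₀ S ν → Σ (Fin n → Set) λ S* → Invariant ν₀ S* ν′
  loop-invariant {S = S} (lp-done _) inv = S , inv
  loop-invariant (lp-step u _ _ _ enum drops rest) inv = loop-invariant rest (Round.invariant inv u enum drops)

  loop-below : ∀ {P ν₀ S ν ν′} → Loop′ P S ν ν′ → Invariant ν₀ S ν →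
               ∀ {μ} → IntoL̄ μ → FeasibleInH μ → (∀ {x} → S x → ν x ≤ˡ μ x) → ∀ x → ν′ x ≤ˡ μ x
  loop-below (lp-done all) _ _ _ ν≤μ x = ν≤μ (all x)
  loop-below {P} (lp-step u _ ¬su u-min enum drops rest) inv μ∈ μ-feasible ν≤μ =
    loop-below rest (Round.invariant inv u enum drops) μ∈ μ-feasible
      (Round.below inv u enum drops P μ∈ μ-feasible ¬su (u-min _) ν≤μ)

  Initialised : Labelling → Labelling → Set
  Initialised ν₀ ν₁ = ∀ v → (IsBase v → ν₁ v ≡ ν₀ v) × (¬ IsBase v → ν₁ v ≡ top)

  initialised-intoL̄ : ∀ {ν₀ ν₁} → IntoL̄ ν₀ → Initialised ν₀ ν₁ → IntoL̄ ν₁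
  initialised-intoL̄ ν₀∈ init v with isBase? v
  ... | yes base = subst InL̄ (sym (proj₁ (init v) base)) (ν₀∈ v)
  ... | no ¬base = subst InL̄ (sym (proj₂ (init v) ¬base)) in-top

  dijkstra-minFeasible : ∀ P {ν₀ ν*} → IntoL̄ ν₀ → Dijkstra G strategy _≺_ T P ν₀ ν* → IsMinFeasible G strategy _≺_ T ν₀ ν*
  dijkstra-minFeasible P {ν₀} {ν*} ν₀∈ (ν₁ , ν₂ , as , init , enum , drops , loop) =
    intoL̄ , progress⇒feasible progress , (λ _ → on-base) , minimal
    where
      open DropSequences IsBase

      into : IntoS as
      into {v} {w} = to (proj₂ enum v w)

      ν₁∈ : IntoL̄ ν₁
      ν₁∈ = initialised-intoL̄ ν₀∈ init

      initial : Invariant ν₀ IsBase ν₂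
      initial = record
        { S?       = isBase?
        ; base⊆S   = id
        ; intoL̄    = drops-intoL̄ drops into ν₁∈
        ; on-base  = λ {v} base → trans (drops-frozen drops into base) (proj₁ (init v) base)
        ; progress = drops-progress drops into ν₁∈ (λ {v} ¬base → inj₁ (proj₂ (init v) ¬base))
        ; bounds   = λ {v} {w} ¬bv bw e → drops-lowerBound drops into ν₁∈ (from (proj₂ enum v w) (e , bw , ¬bv))
        }

      open Invariant (proj₂ (loop-invariant loop initial))

      minimal : ∀ μ → IntoL̄ μ → FeasibleInH μ → (∀ v → IsBase v → μ v ≡ ν₀ v) → ∀ v → ν* v ≤ˡ μ v
      minimal μ μ∈ μ-feasible agree = loop-below loop initial μ∈ μ-feasible
        (λ {x} base → inj₁ (trans (Invariant.on-base initial base) (sym (agree x base))))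

  -- Existence of a run

  enumerate : (Q : Fin n → Fin n → Set) → (∀ v w → Dec (Q v w)) → ∃ λ as → Enumerates′ as Q
  enumerate Q Q? = filter Q?′ pairs , filter⁺ Q?′ (cartesianProduct⁺ (allFin⁺ n) (allFin⁺ n)) ,
                   λ v w → mk⇔ (proj₂ ∘ ∈-filter⁻ Q?′ {xs = pairs})
                               (∈-filter⁺ Q?′ (∈-cartesianProduct⁺ (∈-allFin v) (∈-allFin w)))
    where
      pairs : List (Fin n × Fin n)
      pairs = cartesianProduct (allFin n) (allFin n)
      Q?′ : ∀ (vw : Fin n × Fin n) → Dec (Q (proj₁ vw) (proj₂ vw))
      Q?′ (v , w) = Q? v w

  drops-exist : ∀ as {ν} → IntoL̄ ν → (∀ {v w} → (v , w) ∈ as → w ≢ v) → Σ Labelling λ ν′ → Drops as ν ν′ × IntoL̄ ν′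
  drops-exist []             ν∈ _        = _ , ds-nil , ν∈
  drops-exist ((v , w) ∷ as) {ν} ν∈ distinct
    with drop-exists (pri v) (ν∈ v) (ν∈ w)
  ... | ξ , d with drops-exist as (upd-intoL̄ v ν∈ (IsDropˡ.inL̄ d)) (distinct ∘ there)
  ...   | ν′ , drops , ν′∈ = ν′ , ds-cons (from (isDrop⇔isDropˡ (distinct (here refl))) d) drops , ν′∈

  least-key : ∀ P {ν} → IntoL̄ ν → ∀ a l → Σ (Fin n) λ u → u ∈ (a ∷ l) × (∀ {y} → y ∈ (a ∷ l) → key P ν u ≤ᵏ key P ν y)
  least-key P         ν∈ a []      = a , here refl , λ { (here refl) → inj₁ refl }
  least-key P {ν} ν∈ a (b ∷ l) with least-key P ν∈ b l
  ... | u , u∈ , u-min with <ᵏ-compare (key P ν a) (key P ν u) (key-length P ν a (ν∈ a)) (key-length P ν u (ν∈ u))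
  ...   | tri> _ _ ku<ka = u , there u∈ , λ { (here refl) → inj₂ ku<ka ; (there y∈) → u-min y∈ }
  ...   | tri< ka<ku _ _ = a , here refl , λ { (here refl) → inj₁ refl
                                             ; (there y∈) → ≤ᵏ-trans (key P ν a) (key P ν u) _ (inj₂ ka<ku) (u-min y∈) }
  ...   | tri≈ _ ka≡ku _ = a , here refl , λ { (here refl) → inj₁ refl
                                             ; (there y∈) → ≤ᵏ-trans (key P ν a) (key P ν u) _ (inj₁ ka≡ku) (u-min y∈) }

  unsettled : {S : Fin n → Set} → (∀ x → Dec (S x)) → ℕ
  unsettled S? = length (filter (¬? ∘ S?) (allFin n))

  module _ {S : Fin n → Set} (S? : ∀ x → Dec (S x)) where

    settle? : ∀ u x → Dec (S x ⊎ x ≡ u)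
    settle? u x = S? x ⊎-dec x Fin.≟ u

    unsettled-decreases : ∀ {u} → ¬ S u → unsettled (settle? u) < unsettled S?
    unsettled-decreases {u} ¬su = filter-⊂-length (¬? ∘ settle? u) (¬? ∘ S?) (λ ¬s′x → ¬s′x ∘ inj₁)
                                                  (allFin n) (∈-allFin u) ¬su (λ ¬s′u → ¬s′u (inj₂ refl))

    next-node : ∀ P {ν} → IntoL̄ ν → (∀ v → S v) ⊎ Σ (Fin n) λ u → ¬ S u × (∀ v → ¬ S v → key P ν u ≤ᵏ key P ν v)
    next-node P ν∈ with any? (¬? ∘ S?) (allFin n)
    ... | no none = inj₁ λ v → decidable-stable (S? v) (λ ¬sv → none (Any.map (λ { refl → ¬sv }) (∈-allFin v)))
    ... | yes some with Any.satisfied some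
    ...   | a , ¬sa with least-key P ν∈ a (filter (¬? ∘ S?) (allFin n))
    ...     | u , u∈ , u-min = inj₂ (u , unsettled-member u∈ , λ v ¬sv → u-min (there (∈-filter⁺ (¬? ∘ S?) (∈-allFin v) ¬sv)))
      where
        unsettled-member : ∀ {x} → x ∈ (a ∷ filter (¬? ∘ S?) (allFin n)) → ¬ S x
        unsettled-member (here refl) = ¬sa
        unsettled-member (there x∈)  = proj₂ (∈-filter⁻ (¬? ∘ S?) {xs = allFin n} x∈)

    round-exists : ∀ u {ν} → IntoL̄ ν →
                   Σ (List (Fin n × Fin n)) λ as → Enumerates′ as (λ v w → v ⟶ w × w ≡ u × ¬ (S v ⊎ v ≡ u)) ×
                   Σ Labelling λ ν₁ → Drops as ν ν₁ × IntoL̄ ν₁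
    round-exists u ν∈ with enumerate (λ v w → v ⟶ w × w ≡ u × ¬ (S v ⊎ v ≡ u))
                                     (λ v w → arc? v w ×-dec (w Fin.≟ u ×-dec ¬? (settle? u v)))
    ... | as , enum = as , enum , drops-exist as ν∈ distinct
      where
        distinct : ∀ {v w} → (v , w) ∈ as → w ≢ v
        distinct {v} {w} vw∈ with to (proj₂ enum v w) vw∈
        ... | _ , refl , ¬s′v = ¬s′v ∘ inj₂ ∘ sym

  loop-exists : ∀ P k {S} (S? : ∀ x → Dec (S x)) {ν} → IntoL̄ ν → unsettled S? < k → Σ Labelling (Loop′ P S ν)
  loop-exists P (suc k) S? ν∈ unsettled<k with next-node S? P ν∈
  ... | inj₁ all-settled = _ , lp-done all-settled
  ... | inj₂ (u , ¬su , u-min) with round-exists S? u ν∈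
  ...   | as , enum , ν₁ , drops , ν₁∈
          with loop-exists P k (settle? S? u) ν₁∈ (ℕ.<-≤-trans (unsettled-decreases S? ¬su) (ℕ.≤-pred unsettled<k))
  ...     | ν′ , loop = ν′ , lp-step u as ¬su u-min enum drops loop

  initialise : Labelling → Labelling
  initialise ν₀ v with isBase? v
  ... | yes _ = ν₀ v
  ... | no _  = top

  initialise-initialised : ∀ ν₀ → Initialised ν₀ (initialise ν₀)
  initialise-initialised ν₀ v with isBase? v
  ... | yes base = (λ _ → refl) , (λ ¬base → ⊥-elim (¬base base))
  ... | no ¬base = (λ base → ⊥-elim (¬base base)) , (λ _ → refl)

  into-base-distinct : ∀ {as} → Enumerates′ as (λ v w → v ⟶ w × IsBase w × ¬ IsBase v) →
                       ∀ {v w} → (v , w) ∈ as → w ≢ v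
  into-base-distinct enum {v} {w} vw∈ refl with to (proj₂ enum v w) vw∈
  ... | _ , base , ¬base = ¬base base

  dijkstra-exists : ∀ P {ν₀} → IntoL̄ ν₀ → Σ Labelling (Dijkstra G strategy _≺_ T P ν₀)
  dijkstra-exists P {ν₀} ν₀∈
    with enumerate (λ v w → v ⟶ w × IsBase w × ¬ IsBase v) (λ v w → arc? v w ×-dec (isBase? w ×-dec ¬? (isBase? v)))
  ... | as , enum
    with drops-exist as (initialised-intoL̄ ν₀∈ (initialise-initialised ν₀)) (into-base-distinct enum)
  ...   | ν₂ , drops , ν₂∈ with loop-exists P (suc (unsettled isBase?)) isBase? ν₂∈ ℕ.≤-refl
  ...     | ν* , loop = ν* , initialise ν₀ , ν₂ , as , initialise-initialised ν₀ , enum , drops , loop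

theorem5p3 : {n h : ℕ} (G : Game n h) (τ : OddStrategy G)
    {A : Set} (_≺_ : A → A → Set) → IsStrictTotalOrder _≡_ _≺_ →
    (T : Tree A h) (P : Potentials G τ _≺_ T) (ν : Lab G τ _≺_ T) →
    InT G τ _≺_ T ν →
    Σ (Lab G τ _≺_ T) (λ ν' → Dijkstra G τ _≺_ T P ν ν')
    × (∀ ν' → Dijkstra G τ _≺_ T P ν ν' → IsMinFeasible G τ _≺_ T ν ν')
theorem5p3 G τ _≺_ ≺-sto T P ν ν∈ = dijkstra-exists P ν∈ , λ _ → dijkstra-minFeasible P ν∈
  where open Correctness G τ _≺_ ≺-sto T
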